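{- Let $G=(V\cup\{s\},E)$ be a finite, connected, undirected, loop-free graph (multiple edges allowed) with sink $s\notin V$, and let $T=(V'\cup\{r\},E')$ be a tree branch of $G$. Let $G\setminus T=((V\setminus V')\cup\{s\},E\setminus E')$. Then $L_{G\setminus T}(x)=L_G(x)$.
   Context: A tree branch of $G$ is a subgraph $T=(V'\cup\{r\},E')$ of $G$ which is a tree, such that $d^T(v)=d^G(v)$ for every $v\in V'$ and $r\in V\setminus V'$ (so $T$ is attached to the rest of $G$ only at $r$). Here $d^H(v)$ is the degree of $v$ in $H$ with multiplicity. Configurations are $\eta\in\mathbb{Z}_{\ge0}^V$, stable if $\eta_v\le d^G(v)$ for all $v\in V$. In the stochastic sandpile model with parameter $p\in(0,1)$, a legal stochastic toppling at $x\in V$ (allowed when $\eta_x>d^G(x)$) chooses independently for each edge $e=\{x,y\}$ at $x$ a Bernoulli($p$) variable $B_e$, removes $\sum_eB_e$ grains from $x$ and adds $B_e$ grains to $y$ if $y\ne s$. The Markov chain on stable configurations adds one grain at a random vertex of $V$ (distribution with support $V$) and then performs legal stochastic topplings until stable; ${\sf Sto}(G)$ is its recurrent class containing $\eta^{\max}=(d^G(v))_{v\in V}$. The lacking number is $l_\eta(v)=d^G(v)-\eta_v$, $\ell(\eta)=\sum_{v\in V}l_\eta(v)$, and the lacking polynomial is $L_G(x)=\sum_{\eta\in{\sf Sto}(G)}x^{\ell(\eta)}$. -}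

module Defs where

open import Data.Nat using (ℕ; zero; suc; _+_; _∸_; _≤_; _<_)
open import Data.Bool using (Bool; true; false; if_then_else_; _∧_; _∨_; not)
open import Data.Fin using (Fin; _≟_)
open import Data.Product using (Σ; _×_; _,_)
open import Data.Sum using (_⊎_)
open import Data.List using (List; []; _∷_; length; _++_)
open import Data.List.Membership.Propositional using (_∈_)
open import Data.List.Relation.Binary.Permutation.Propositional using (_↭_)
open import Data.Vec using (Vec; lookup; tabulate; toList; sum)
open import Relation.Nullary using (¬_)
open import Relation.Nullary.Decidable using (⌊_⌋)
open import Relation.Binary.PropositionalEquality using (_≡_)
open import Relation.Binary.Construct.Closure.ReflexiveTransitive using (Star)
open import Function.Bundles using (_⇔_)

-- The non-sink vertex set V is the mask inV; the vertex set of the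
-- graph is V ∪ {sink}.  Edges form a multiset (a list) of unordered
-- pairs; parallel edges are repeated list entries.

Edge : ℕ → Set
Edge m = Fin m × Fin m

record SGraph (m : ℕ) : Set where
  constructor sgraph
  field
    inV   : Fin m → Bool
    sink  : Fin m
    edges : List (Edge m)
open SGraph public

_==_ : ∀ {m} → Fin m → Fin m → Bool
x == y = ⌊ x ≟ y ⌋

incident : ∀ {m} → Fin m → Edge m → Bool
incident x (a , b) = (a == x) ∨ (b == x)

other : ∀ {m} → Fin m → Edge m → Fin m
other x (a , b) = if a == x then b else a

deg : ∀ {m} → List (Edge m) → Fin m → ℕ
deg []      x = 0
deg (e ∷ E) x = (if incident x e then 1 else 0) + deg E x

Adj : ∀ {m} → List (Edge m) → Fin m → Fin m → Set
Adj E u v = ((u , v) ∈ E) ⊎ ((v , u) ∈ E)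

countV : ∀ {m} → (Fin m → Bool) → ℕ
countV {m} p = sum (tabulate {n = m} (λ v → if p v then 1 else 0))

record WellFormed {m : ℕ} (G : SGraph m) : Set where
  field
    sink∉V    : inV G (sink G) ≡ false
    loopFree  : ∀ {a b} → (a , b) ∈ edges G → ¬ (a ≡ b)
    endpoints : ∀ {a b} → (a , b) ∈ edges G →
                (inV G a ≡ true ⊎ a ≡ sink G) × (inV G b ≡ true ⊎ b ≡ sink G)
    connected : ∀ v → inV G v ≡ true → Star (Adj (edges G)) v (sink G)

Config : ℕ → Set
Config m = Vec ℕ m

module _ {m : ℕ} (G : SGraph m) where

  d : Fin m → ℕ
  d = deg (edges G)

  Stable : Config m → Set
  Stable η = ∀ v → inV G v ≡ true → lookup η v ≤ d v

  ηmax : Config m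
  ηmax = tabulate (λ v → if inV G v then d v else 0)

  addGrain : Fin m → Config m → Config m
  addGrain v η = tabulate (λ u → if u == v then suc (lookup η u) else lookup η u)

  -- number of grains leaving x, given Bernoulli outcomes B (one per edge)
  lost : Fin m → List (Edge m) → List Bool → ℕ
  lost x []      _       = 0
  lost x (e ∷ E) []      = 0
  lost x (e ∷ E) (b ∷ B) = (if b ∧ incident x e then 1 else 0) + lost x E B

  gain : Fin m → Fin m → List (Edge m) → List Bool → ℕ
  gain x y []      _       = 0
  gain x y (e ∷ E) []      = 0
  gain x y (e ∷ E) (b ∷ B) =
    (if b ∧ incident x e ∧ (other x e == y) then 1 else 0) + gain x y E B

  toppleAt : Fin m → List Bool → Config m → Config m
  toppleAt x B η = tabulate λ u →
    if u == x then lookup η x ∸ lost x (edges G) B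
    else (if u == sink G then lookup η u
          else lookup η u + gain x u (edges G) B)

  -- legal stochastic toppling, with any outcome (B_e)_e of positive probability
  data Topple : Config m → Config m → Set where
    topple : ∀ {η} (x : Fin m) (B : Vec Bool (length (edges G))) →
             inV G x ≡ true → d x < lookup η x →
             Topple η (toppleAt x (toList B) η)

  -- positive-probability transition of the Markov chain
  Step : Config m → Config m → Set
  Step η η' = Σ (Fin m) λ v → inV G v ≡ true ×
              Star Topple (addGrain v η) η' × Stable η'

  -- Sto(G): the communicating (recurrent) class of ηmax
  Sto : Config m → Set
  Sto η = Star Step ηmax η × Star Step η ηmax

  lack : Config m → ℕ
  lack η = sum (tabulate (λ v → if inV G v then d v ∸ lookup η v else 0))

Card : ∀ {m} → (Config m → Set) → ℕ → Set
Card {m} P n = Σ (Vec (Config m) n) λ xs →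
  (∀ i j → lookup xs i ≡ lookup xs j → i ≡ j) ×
  (∀ η → P η ⇔ (Σ (Fin n) λ i → lookup xs i ≡ η))

-- the coefficient of x^k in the lacking polynomial L_G(x) is n
IsLCoeff : ∀ {m} → SGraph m → ℕ → ℕ → Set
IsLCoeff G k n = Card (λ η → Sto G η × lack G η ≡ k) n

record TreeBranch {m : ℕ} (G : SGraph m) : Set where
  field
    inT    : Fin m → Bool
    root   : Fin m
    tEdges : List (Edge m)
    rest   : List (Edge m)
    split  : edges G ↭ (tEdges ++ rest)
    inT⊆V  : ∀ v → inT v ≡ true → inV G v ≡ true
    root∈V : inV G root ≡ true
    root∉T : inT root ≡ false
    tEndpoints : ∀ {a b} → (a , b) ∈ tEdges →
                 (inT a ≡ true ⊎ a ≡ root) × (inT b ≡ true ⊎ b ≡ root)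
    -- T is a tree: connected, with |E'| = |V' ∪ {r}| - 1
    tConnected : ∀ v → inT v ≡ true → Star (Adj tEdges) v root
    tEdgeCount : length tEdges ≡ countV inT
    fullDegree : ∀ v → inT v ≡ true → deg tEdges v ≡ deg (edges G) v
open TreeBranch public

_∖T_ : ∀ {m} (G : SGraph m) → TreeBranch G → SGraph m
G ∖T T = sgraph (λ v → inV G v ∧ not (inT T v)) (sink G) (rest T)

{-# OPTIONS --safe #-}
-- A nonempty tree branch has a leaf ℓ ≠ r, and deleting ℓ together with its
-- edge to its neighbour u leaves a tree branch with the same complement G ∖ T, so it suffices that
-- deleting a leaf does not change the lacking polynomial.  The map lift, which puts one grain on ℓ
-- and one extra grain on u, is a lacking-number preserving bijection onto Sto(G) from Sto(G⁻), G⁻ = G − ℓ: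
-- recurrent configurations of G always hold exactly one grain on ℓ and at least one on u, and under
-- the inverse map merge, which moves the surplus of ℓ and u back onto u, every toppling of G becomes
-- at most one toppling of G⁻.
module Submission where

open import Defs
open import Data.Nat using (ℕ; zero; suc; _+_; _*_; _∸_; _≤_; _<_; z≤n; s≤s; pred; >-nonZero)
open import Data.Nat.Properties hiding (_≟_)
import Data.Nat.Properties as ℕₚ
open import Data.Bool using (Bool; true; false; if_then_else_; _∧_; _∨_; not)
import Data.Bool.Properties as Boolₚ
open import Data.Fin using (Fin; _≟_; zero; suc)
import Data.Fin.Properties as Finₚ
open import Data.Product using (Σ; _×_; _,_; proj₁; proj₂)
open import Data.Sum using (_⊎_; inj₁; inj₂)
open import Data.List using (List; []; _∷_; length; _++_)
open import Data.List.Relation.Unary.Any using (here; there)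
open import Data.List.Membership.Propositional using (_∈_)
open import Data.List.Membership.Propositional.Properties using (∈-++⁺ˡ; ∈-++⁺ʳ; ∈-++⁻)
open import Data.List.Relation.Binary.Permutation.Propositional
  using (_↭_; refl; prep; swap; trans; ↭-sym; ↭-trans)
open import Data.List.Relation.Binary.Permutation.Propositional.Properties
  using (∈-resp-↭; ↭-length; ++⁺ʳ)
open import Data.Vec using (Vec; lookup; tabulate; toList; sum; map; _∷_)
open import Data.Vec.Properties using (lookup∘tabulate; tabulate∘lookup; tabulate-cong; lookup-map)
open import Data.Empty using (⊥-elim)
open import Relation.Nullary using (¬_; yes; no; _×-dec_)
open import Relation.Nullary.Decidable using (isYes≗does; dec-true; dec-false)
open import Relation.Binary.PropositionalEquality
  using (_≡_; refl; sym; cong; cong₂; subst; subst₂; module ≡-Reasoning)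
  renaming (trans to ≡-trans)
open import Relation.Binary.Construct.Closure.ReflexiveTransitive
  using (Star; ε; _◅_; _◅◅_; gmap)
open import Function.Bundles using (_⇔_; mk⇔; Equivalence)
open import Function.Construct.Composition using (_⇔-∘_)
open import Algebra.Properties.CommutativeSemigroup +-commutativeSemigroup
  using (x∙yz≈y∙xz; interchange)

vec-ext : ∀ {A : Set} {n} {xs ys : Vec A n} → (∀ i → lookup xs i ≡ lookup ys i) → xs ≡ ys
vec-ext {xs = xs} {ys} h =
  ≡-trans (sym (tabulate∘lookup xs)) (≡-trans (tabulate-cong h) (tabulate∘lookup ys))

==-refl : ∀ {m} (x : Fin m) → (x == x) ≡ true
==-refl x = ≡-trans (isYes≗does (x ≟ x)) (dec-true (x ≟ x) refl)

==-≢ : ∀ {m} {x y : Fin m} → ¬ x ≡ y → (x == y) ≡ false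
==-≢ {x = x} {y} x≢y = ≡-trans (isYes≗does (x ≟ y)) (dec-false (x ≟ y) x≢y)

[_]ᵇ : Bool → ℕ
[ c ]ᵇ = if c then 1 else 0

Card-resp-bij : ∀ {m n} {P Q : Config m → Set} (f g : Config m → Config m) →
  (∀ η → P η → Q (f η)) → (∀ ζ → Q ζ → P (g ζ)) →
  (∀ η → P η → g (f η) ≡ η) → (∀ ζ → Q ζ → f (g ζ) ≡ ζ) →
  Card P n → Card Q n
Card-resp-bij {P = P} {Q} f g P⇒Qf Q⇒Pg gf≡id fg≡id (xs , inj , mem) = map f xs , inj′ , mem′
  where
  Pxs : ∀ i → P (lookup xs i)
  Pxs i = Equivalence.from (mem (lookup xs i)) (i , refl)
  inj′ : ∀ i j → lookup (map f xs) i ≡ lookup (map f xs) j → i ≡ j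
  inj′ i j h = inj i j (begin
    lookup xs i           ≡⟨ sym (gf≡id _ (Pxs i)) ⟩
    g (f (lookup xs i))   ≡⟨ cong g (≡-trans (sym (lookup-map i f xs)) (≡-trans h (lookup-map j f xs))) ⟩
    g (f (lookup xs j))   ≡⟨ gf≡id _ (Pxs j) ⟩
    lookup xs j           ∎)
    where open ≡-Reasoning
  mem′ : ∀ η → Q η ⇔ Σ _ (λ i → lookup (map f xs) i ≡ η)
  mem′ η = mk⇔ to from
    where
    to : Q η → Σ _ (λ i → lookup (map f xs) i ≡ η)
    to q with Equivalence.to (mem (g η)) (Q⇒Pg η q)
    ... | i , e = i , ≡-trans (lookup-map i f xs) (≡-trans (cong f e) (fg≡id η q))
    from : Σ _ (λ i → lookup (map f xs) i ≡ η) → Q η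
    from (i , e) = subst Q (≡-trans (sym (lookup-map i f xs)) e) (P⇒Qf _ (Pxs i))

Card-resp-⇔ : ∀ {m n} {P Q : Config m → Set} → (∀ η → P η ⇔ Q η) → Card P n → Card Q n
Card-resp-⇔ P⇔Q = Card-resp-bij (λ η → η) (λ η → η)
  (λ η → Equivalence.to (P⇔Q η)) (λ η → Equivalence.from (P⇔Q η)) (λ _ _ → refl) (λ _ _ → refl)

∧-true : ∀ {c d} → c ∧ d ≡ true → c ≡ true × d ≡ true
∧-true {true} {true} _ = refl , refl

incident-fst : ∀ {m} (a b : Fin m) → incident a (a , b) ≡ true
incident-fst a b rewrite ==-refl a = refl

incident-snd : ∀ {m} (a b : Fin m) → incident b (a , b) ≡ true
incident-snd a b rewrite ==-refl b = Boolₚ.∨-zeroʳ (a == b)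

incident-other : ∀ {m} (x y : Fin m) e → incident x e ∧ (other x e == y) ≡ true → incident y e ≡ true
incident-other x y (a , b) h with a ≟ x
... | yes _ = ≡-trans (cong ((a == y) ∨_) h) (Boolₚ.∨-zeroʳ (a == y))
... | no _  = cong (_∨ (b == y)) (proj₂ (∧-true h))

deg-++ : ∀ {m} (E F : List (Edge m)) v → deg (E ++ F) v ≡ deg E v + deg F v
deg-++ []      F v = refl
deg-++ (e ∷ E) F v = ≡-trans (cong ([ incident v e ]ᵇ +_) (deg-++ E F v)) (sym (+-assoc _ (deg E v) (deg F v)))

deg-↭ : ∀ {m} {E F : List (Edge m)} → E ↭ F → ∀ v → deg E v ≡ deg F v
deg-↭ refl         v = refl
deg-↭ (prep e P)   v = cong (_ +_) (deg-↭ P v)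
deg-↭ (swap e f P) v = ≡-trans (cong (λ n → [ incident v e ]ᵇ + ([ incident v f ]ᵇ + n)) (deg-↭ P v))
                               (x∙yz≈y∙xz [ incident v e ]ᵇ [ incident v f ]ᵇ _)
deg-↭ (trans P Q)  v = ≡-trans (deg-↭ P v) (deg-↭ Q v)

deg≡0-head : ∀ {m} {e} {E : List (Edge m)} {x} → deg (e ∷ E) x ≡ 0 → incident x e ≡ false
deg≡0-head {e = e} {x = x} h with incident x e
... | false = refl

deg≡0-tail : ∀ {m} {e} {E : List (Edge m)} {x} → deg (e ∷ E) x ≡ 0 → deg E x ≡ 0
deg≡0-tail {e = e} {x = x} h with incident x e
... | false = h

deg≡0-∉ : ∀ {m} {E : List (Edge m)} {e x} → deg E x ≡ 0 → e ∈ E → incident x e ≡ false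
deg≡0-∉ {E = e ∷ E} h (here refl) = deg≡0-head {e = e} {E = E} h
deg≡0-∉ {E = e ∷ E} h (there e∈E) = deg≡0-∉ (deg≡0-tail {e = e} {E = E} h) e∈E

∈⇒deg≥1 : ∀ {m} {E : List (Edge m)} {a b} → (a , b) ∈ E → 1 ≤ deg E a × 1 ≤ deg E b
∈⇒deg≥1 {a = a} {b} (here refl) rewrite incident-fst a b | incident-snd a b = s≤s z≤n , s≤s z≤n
∈⇒deg≥1 {E = e ∷ E} {a} {b} (there ab∈E) =
  ≤-trans (proj₁ (∈⇒deg≥1 ab∈E)) (m≤n+m (deg E a) _) , ≤-trans (proj₂ (∈⇒deg≥1 ab∈E)) (m≤n+m (deg E b) _)

Adj⇒deg≥1 : ∀ {m} {E : List (Edge m)} {v w} → Adj E v w → 1 ≤ deg E v × 1 ≤ deg E w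
Adj⇒deg≥1 (inj₁ vw∈E) = ∈⇒deg≥1 vw∈E
Adj⇒deg≥1 (inj₂ wv∈E) = let (w≥1 , v≥1) = ∈⇒deg≥1 wv∈E in v≥1 , w≥1

module _ {m} (G : SGraph m) where

  lost≤deg : ∀ x E B → lost G x E B ≤ deg E x
  lost≤deg x []      B       = z≤n
  lost≤deg x (e ∷ E) []      = z≤n
  lost≤deg x (e ∷ E) (b ∷ B) = +-mono-≤ (coin≤ b (incident x e)) (lost≤deg x E B)
    where
    coin≤ : ∀ b c → [ b ∧ c ]ᵇ ≤ [ c ]ᵇ
    coin≤ true  c = ≤-refl
    coin≤ false c = z≤n

  lost-isolated : ∀ x E B → deg E x ≡ 0 → lost G x E B ≡ 0
  lost-isolated x E B h = n≤0⇒n≡0 (subst (lost G x E B ≤_) h (lost≤deg x E B))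

  gain-from-isolated : ∀ x y E B → deg E x ≡ 0 → gain G x y E B ≡ 0
  gain-from-isolated x y []      B       h = refl
  gain-from-isolated x y (e ∷ E) []      h = refl
  gain-from-isolated x y (e ∷ E) (b ∷ B) h
    rewrite deg≡0-head {e = e} {E = E} h | gain-from-isolated x y E B (deg≡0-tail {e = e} {E = E} h)
    = ≡-trans (+-identityʳ _) (cong [_]ᵇ (Boolₚ.∧-zeroʳ b))

  gain-to-isolated : ∀ x y E B → deg E y ≡ 0 → gain G x y E B ≡ 0
  gain-to-isolated x y []      B       h = refl
  gain-to-isolated x y (e ∷ E) []      h = refl
  gain-to-isolated x y (e ∷ E) (b ∷ B) h
    rewrite gain-to-isolated x y E B (deg≡0-tail {e = e} {E = E} h) = coin≡0 b (incident x e ∧ (other x e == y)) refl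
    where
    coin≡0 : ∀ b c → c ≡ incident x e ∧ (other x e == y) → [ b ∧ c ]ᵇ + 0 ≡ 0
    coin≡0 false c     _  = refl
    coin≡0 true  false _  = refl
    coin≡0 true  true  eq with ≡-trans (sym (deg≡0-head {e = e} {E = E} h)) (incident-other x y e (sym eq))
    ... | ()

module _ {m} (G H : SGraph m) where

  lost-graph-irrelevant : ∀ x E B → lost G x E B ≡ lost H x E B
  lost-graph-irrelevant x []      B       = refl
  lost-graph-irrelevant x (e ∷ E) []      = refl
  lost-graph-irrelevant x (e ∷ E) (b ∷ B) = cong (_ +_) (lost-graph-irrelevant x E B)

  gain-graph-irrelevant : ∀ x y E B → gain G x y E B ≡ gain H x y E B
  gain-graph-irrelevant x y []      B       = refl
  gain-graph-irrelevant x y (e ∷ E) []      = refl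
  gain-graph-irrelevant x y (e ∷ E) (b ∷ B) = cong (_ +_) (gain-graph-irrelevant x y E B)

module _ {m} (G : SGraph m) where

  coins-↭ : ∀ {E F : List (Edge m)} → E ↭ F → (B : Vec Bool (length E)) →
    Σ (Vec Bool (length F)) λ C → (∀ x → lost G x F (toList C) ≡ lost G x E (toList B)) ×
                                  (∀ x y → gain G x y F (toList C) ≡ gain G x y E (toList B))
  coins-↭ refl B = B , (λ _ → refl) , (λ _ _ → refl)
  coins-↭ (prep e P) (b ∷ B) with coins-↭ P B
  ... | C , l , g = b ∷ C , (λ x → cong (_ +_) (l x)) , (λ x y → cong (_ +_) (g x y))
  coins-↭ {e ∷ f ∷ E} {_ ∷ _ ∷ F} (swap e f P) (b₁ ∷ b₂ ∷ B) with coins-↭ P B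
  ... | C , l , g = b₂ ∷ b₁ ∷ C , lost-swap , gain-swap
    where
    lost-swap : ∀ x → lost G x (f ∷ e ∷ F) (b₂ ∷ b₁ ∷ toList C) ≡ lost G x (e ∷ f ∷ E) (b₁ ∷ b₂ ∷ toList B)
    lost-swap x = ≡-trans (cong (λ n → [ b₂ ∧ incident x f ]ᵇ + ([ b₁ ∧ incident x e ]ᵇ + n)) (l x))
                          (x∙yz≈y∙xz [ b₂ ∧ incident x f ]ᵇ [ b₁ ∧ incident x e ]ᵇ _)
    gain-swap : ∀ x y → gain G x y (f ∷ e ∷ F) (b₂ ∷ b₁ ∷ toList C) ≡ gain G x y (e ∷ f ∷ E) (b₁ ∷ b₂ ∷ toList B)
    gain-swap x y = ≡-trans (cong (λ n → [ b₂ ∧ (incident x f ∧ (other x f == y)) ]ᵇ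
                                       + ([ b₁ ∧ (incident x e ∧ (other x e == y)) ]ᵇ + n)) (g x y))
                            (x∙yz≈y∙xz [ b₂ ∧ (incident x f ∧ (other x f == y)) ]ᵇ
                                       [ b₁ ∧ (incident x e ∧ (other x e == y)) ]ᵇ _)
  coins-↭ (trans P Q) B with coins-↭ P B
  ... | C₁ , l₁ , g₁ with coins-↭ Q C₁
  ...   | C₂ , l₂ , g₂ = C₂ , (λ x → ≡-trans (l₂ x) (l₁ x)) , (λ x y → ≡-trans (g₂ x y) (g₁ x y))

module _ {m} (G : SGraph m) where

  lookup-toppleAt : ∀ x B η w → lookup (toppleAt G x B η) w ≡
    (if w == x then lookup η x ∸ lost G x (edges G) B
     else (if w == sink G then lookup η w else lookup η w + gain G x w (edges G) B))
  lookup-toppleAt x B η w = lookup∘tabulate _ w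

  lookup-addGrain : ∀ v η w → lookup (addGrain G v η) w ≡ (if w == v then suc (lookup η w) else lookup η w)
  lookup-addGrain v η w = lookup∘tabulate _ w

  lookup-ηmax : ∀ w → lookup (ηmax G) w ≡ (if inV G w then d G w else 0)
  lookup-ηmax w = lookup∘tabulate _ w

module EdgePermutation {m} (p q : Fin m → Bool) (s : Fin m) {E F : List (Edge m)}
  (p≗q : ∀ v → p v ≡ q v) (E↭F : E ↭ F) where

  private
    G H : SGraph m
    G = sgraph p s E
    H = sgraph q s F

  Topple⇒ : ∀ {η ζ} → Topple G η ζ → Topple H η ζ
  Topple⇒ {η} (topple x B px d<η) with coins-↭ G E↭F B
  ... | C , lost≡ , gain≡ =
    subst (Topple H η) same-result
      (topple x C (≡-trans (sym (p≗q x)) px) (subst (_< lookup η x) (deg-↭ E↭F x) d<η))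
    where
    same-result : toppleAt H x (toList C) η ≡ toppleAt G x (toList B) η
    same-result = vec-ext λ w → begin
      lookup (toppleAt H x (toList C) η) w
        ≡⟨ lookup-toppleAt H x (toList C) η w ⟩
      (if w == x then lookup η x ∸ lost H x F (toList C)
       else (if w == s then lookup η w else lookup η w + gain H x w F (toList C)))
        ≡⟨ cong₂ (λ l g → if w == x then lookup η x ∸ l else (if w == s then lookup η w else lookup η w + g))
                 (≡-trans (lost-graph-irrelevant H G x F (toList C)) (lost≡ x))
                 (≡-trans (gain-graph-irrelevant H G x w F (toList C)) (gain≡ x w)) ⟩
      (if w == x then lookup η x ∸ lost G x E (toList B)
       else (if w == s then lookup η w else lookup η w + gain G x w E (toList B)))
        ≡⟨ sym (lookup-toppleAt G x (toList B) η w) ⟩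
      lookup (toppleAt G x (toList B) η) w ∎
      where open ≡-Reasoning

  ηmax≡ : ηmax G ≡ ηmax H
  ηmax≡ = tabulate-cong λ v → cong₂ (λ c n → if c then n else 0) (p≗q v) (deg-↭ E↭F v)

  Stable⇒ : ∀ {η} → Stable G η → Stable H η
  Stable⇒ {η} st v qv = subst (lookup η v ≤_) (deg-↭ E↭F v) (st v (≡-trans (p≗q v) qv))

  Step⇒ : ∀ {η ζ} → Step G η ζ → Step H η ζ
  Step⇒ {ζ = ζ} (v , pv , topples , st) =
    v , ≡-trans (sym (p≗q v)) pv , gmap (λ ξ → ξ) (λ {ξ} {ξ′} → Topple⇒ {ξ} {ξ′}) topples , Stable⇒ {ζ} st

  Sto⇒ : ∀ {η} → Sto G η → Sto H η
  Sto⇒ {η} (from-max , to-max) =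
    subst (λ ξ → Star (Step H) ξ η) ηmax≡ (gmap (λ ξ → ξ) (λ {ξ} {ξ′} → Step⇒ {ξ} {ξ′}) from-max) ,
    subst (Star (Step H) η) ηmax≡ (gmap (λ ξ → ξ) (λ {ξ} {ξ′} → Step⇒ {ξ} {ξ′}) to-max)

  lack≡ : ∀ η → lack G η ≡ lack H η
  lack≡ η = cong sum (tabulate-cong λ v →
    cong₂ (λ c n → if c then n ∸ lookup η v else 0) (p≗q v) (deg-↭ E↭F v))

IsLCoeff-cong : ∀ {m} {p q : Fin m → Bool} {s : Fin m} {E F : List (Edge m)} →
  (∀ v → p v ≡ q v) → E ↭ F → ∀ k n → IsLCoeff (sgraph p s E) k n ⇔ IsLCoeff (sgraph q s F) k n
IsLCoeff-cong {p = p} {q} {s} {E} {F} p≗q E↭F k n =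
  mk⇔ (Card-resp-⇔ λ η → mk⇔ (forth η) (back η)) (Card-resp-⇔ λ η → mk⇔ (back η) (forth η))
  where
  module PQ = EdgePermutation p q s p≗q E↭F
  module QP = EdgePermutation q p s (λ v → sym (p≗q v)) (↭-sym E↭F)
  G H : SGraph _
  G = sgraph p s E
  H = sgraph q s F
  forth : ∀ η → Sto G η × lack G η ≡ k → Sto H η × lack H η ≡ k
  forth η (sto , lack≡k) = PQ.Sto⇒ sto , ≡-trans (sym (PQ.lack≡ η)) lack≡k
  back : ∀ η → Sto H η × lack H η ≡ k → Sto G η × lack G η ≡ k
  back η (sto , lack≡k) = QP.Sto⇒ sto , ≡-trans (sym (QP.lack≡ η)) lack≡k

suc-pred≥1 : ∀ {n} → 1 ≤ n → suc (pred n) ≡ n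
suc-pred≥1 {n} n≥1 = suc-pred n {{>-nonZero n≥1}}

pred-∸-coin : ∀ A C L c → [ c ]ᵇ + L ≤ A → pred (suc A ∸ ([ c ]ᵇ + L)) + pred (suc C + [ c ]ᵇ) ≡ (A + C) ∸ L
pred-∸-coin A C L false L≤A = begin
  pred (suc A ∸ L) + (C + 0) ≡⟨ cong₂ _+_ (cong pred (+-∸-assoc 1 L≤A)) (+-identityʳ C) ⟩
  (A ∸ L) + C                ≡⟨ sym (+-∸-comm C L≤A) ⟩
  (A + C) ∸ L                ∎
  where open ≡-Reasoning
pred-∸-coin (suc A) C L true (s≤s L≤A) = begin
  pred (suc A ∸ L) + (C + 1) ≡⟨ cong₂ _+_ (cong pred (+-∸-assoc 1 L≤A)) (+-comm C 1) ⟩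
  (A ∸ L) + suc C            ≡⟨ sym (+-∸-comm (suc C) L≤A) ⟩
  (A + suc C) ∸ L            ≡⟨ cong (_∸ L) (+-suc A C) ⟩
  (suc A + C) ∸ L            ∎
  where open ≡-Reasoning

record Joins {m} (ℓ u : Fin m) (e : Edge m) : Set where
  field
    ℓ≢u      : ¬ ℓ ≡ u
    ℓ-on-e   : incident ℓ e ≡ true
    u-on-e   : incident u e ≡ true
    other-ℓ  : other ℓ e ≡ u
    other-u  : other u e ≡ ℓ
    only-ℓ-u : ∀ x → ¬ x ≡ ℓ → ¬ x ≡ u → incident x e ≡ false

module LeafRemoval {m} (p : Fin m → Bool) (s : Fin m) (e : Edge m) (R : List (Edge m)) (ℓ u : Fin m)
  (s∉V : p s ≡ false) (ℓ∈V : p ℓ ≡ true) (u∈V : p u ≡ true)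
  (joins : Joins ℓ u e) (ℓ-isolated : deg R ℓ ≡ 0) where

  open Joins joins

  G : SGraph m
  G = sgraph p s (e ∷ R)

  p⁻ : Fin m → Bool
  p⁻ v = p v ∧ not (v == ℓ)

  G⁻ : SGraph m
  G⁻ = sgraph p⁻ s R

  ℓ≢s : ¬ ℓ ≡ s
  ℓ≢s refl with ≡-trans (sym s∉V) ℓ∈V
  ... | ()

  u≢s : ¬ u ≡ s
  u≢s refl with ≡-trans (sym s∉V) u∈V
  ... | ()

  u≢ℓ : ¬ u ≡ ℓ
  u≢ℓ u≡ℓ = ℓ≢u (sym u≡ℓ)

  p⁻-ℓ : p⁻ ℓ ≡ false
  p⁻-ℓ rewrite ==-refl ℓ = Boolₚ.∧-zeroʳ (p ℓ)

  p⁻-≢ℓ : ∀ {x} → ¬ x ≡ ℓ → p⁻ x ≡ p x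
  p⁻-≢ℓ {x} x≢ℓ rewrite ==-≢ x≢ℓ = Boolₚ.∧-identityʳ (p x)

  p⁻-u : p⁻ u ≡ true
  p⁻-u = ≡-trans (p⁻-≢ℓ u≢ℓ) u∈V

  p⁻⇒≢ℓ : ∀ {x} → p⁻ x ≡ true → ¬ x ≡ ℓ
  p⁻⇒≢ℓ h refl with ≡-trans (sym p⁻-ℓ) h
  ... | ()

  p⁻⇒p : ∀ {x} → p⁻ x ≡ true → p x ≡ true
  p⁻⇒p h = ≡-trans (sym (p⁻-≢ℓ (p⁻⇒≢ℓ h))) h

  d-ℓ : d G ℓ ≡ 1
  d-ℓ rewrite ℓ-on-e | ℓ-isolated = refl

  d-u : d G u ≡ suc (d G⁻ u)
  d-u rewrite u-on-e = refl

  d-elsewhere : ∀ {x} → ¬ x ≡ ℓ → ¬ x ≡ u → d G x ≡ d G⁻ x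
  d-elsewhere {x} x≢ℓ x≢u rewrite only-ℓ-u x x≢ℓ x≢u = refl

  data Position (w : Fin m) : Set where
    at-ℓ      : w ≡ ℓ → Position w
    at-u      : w ≡ u → Position w
    elsewhere : ¬ w ≡ ℓ → ¬ w ≡ u → Position w

  position : ∀ w → Position w
  position w with w ≟ ℓ | w ≟ u
  ... | yes w≡ℓ | _       = at-ℓ w≡ℓ
  ... | no _    | yes w≡u = at-u w≡u
  ... | no w≢ℓ  | no w≢u  = elsewhere w≢ℓ w≢u

  lift-entry : Config m → Fin m → ℕ
  lift-entry η v = if v == ℓ then 1 else (if v == u then suc (lookup η v) else lookup η v)

  lift : Config m → Config m
  lift η = tabulate (lift-entry η)

  merge-entry : Config m → Fin m → ℕ
  merge-entry ζ v = if v == ℓ then 0 else (if v == u then pred (lookup ζ u) + pred (lookup ζ ℓ) else lookup ζ v)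

  merge : Config m → Config m
  merge ζ = tabulate (merge-entry ζ)

  lift-ℓ : ∀ η → lookup (lift η) ℓ ≡ 1
  lift-ℓ η rewrite lookup∘tabulate (lift-entry η) ℓ | ==-refl ℓ = refl

  lift-u : ∀ η → lookup (lift η) u ≡ suc (lookup η u)
  lift-u η rewrite lookup∘tabulate (lift-entry η) u | ==-≢ u≢ℓ | ==-refl u = refl

  lift-elsewhere : ∀ η {w} → ¬ w ≡ ℓ → ¬ w ≡ u → lookup (lift η) w ≡ lookup η w
  lift-elsewhere η {w} w≢ℓ w≢u rewrite lookup∘tabulate (lift-entry η) w | ==-≢ w≢ℓ | ==-≢ w≢u = refl

  merge-ℓ : ∀ ζ → lookup (merge ζ) ℓ ≡ 0
  merge-ℓ ζ rewrite lookup∘tabulate (merge-entry ζ) ℓ | ==-refl ℓ = refl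

  merge-u : ∀ ζ → lookup (merge ζ) u ≡ pred (lookup ζ u) + pred (lookup ζ ℓ)
  merge-u ζ rewrite lookup∘tabulate (merge-entry ζ) u | ==-≢ u≢ℓ | ==-refl u = refl

  merge-elsewhere : ∀ ζ {w} → ¬ w ≡ ℓ → ¬ w ≡ u → lookup (merge ζ) w ≡ lookup ζ w
  merge-elsewhere ζ {w} w≢ℓ w≢u rewrite lookup∘tabulate (merge-entry ζ) w | ==-≢ w≢ℓ | ==-≢ w≢u = refl

  lift-ηmax : lift (ηmax G⁻) ≡ ηmax G
  lift-ηmax = vec-ext pointwise
    where
    pointwise : ∀ w → lookup (lift (ηmax G⁻)) w ≡ lookup (ηmax G) w
    pointwise w with position w
    ... | at-ℓ refl rewrite lift-ℓ (ηmax G⁻) | lookup-ηmax G ℓ | ℓ∈V | d-ℓ = refl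
    ... | at-u refl rewrite lift-u (ηmax G⁻) | lookup-ηmax G u | lookup-ηmax G⁻ u | ==-≢ u≢ℓ | u∈V | d-u = refl
    ... | elsewhere w≢ℓ w≢u rewrite lift-elsewhere (ηmax G⁻) w≢ℓ w≢u | lookup-ηmax G w | lookup-ηmax G⁻ w
                                  | p⁻-≢ℓ w≢ℓ | d-elsewhere w≢ℓ w≢u = refl

  lift-addGrain : ∀ v η → ¬ v ≡ ℓ → lift (addGrain G⁻ v η) ≡ addGrain G v (lift η)
  lift-addGrain v η v≢ℓ = vec-ext pointwise
    where
    pointwise : ∀ w → lookup (lift (addGrain G⁻ v η)) w ≡ lookup (addGrain G v (lift η)) w
    pointwise w with position w
    ... | at-ℓ refl rewrite lift-ℓ (addGrain G⁻ v η) | lookup-addGrain G v (lift η) ℓ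
                          | ==-≢ (λ ℓ≡v → v≢ℓ (sym ℓ≡v)) | lift-ℓ η = refl
    ... | at-u refl rewrite lift-u (addGrain G⁻ v η) | lookup-addGrain G v (lift η) u
                          | lookup-addGrain G⁻ v η u | lift-u η with u == v
    ...   | true  = refl
    ...   | false = refl
    pointwise w | elsewhere w≢ℓ w≢u rewrite lift-elsewhere (addGrain G⁻ v η) w≢ℓ w≢u
                                          | lookup-addGrain G v (lift η) w | lookup-addGrain G⁻ v η w
                                          | lift-elsewhere η w≢ℓ w≢u = refl

  -- A toppling of G⁻ is the toppling of G in which the coin of the leaf edge comes up false.
  lift-Topple : ∀ {η ζ} → Topple G⁻ η ζ → Topple G (lift η) (lift ζ)
  lift-Topple {η} (topple x B p⁻x d<η) =
    subst (Topple G (lift η)) same-result (topple x (false ∷ B) (p⁻⇒p p⁻x) d<lift)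
    where
    x≢ℓ : ¬ x ≡ ℓ
    x≢ℓ = p⁻⇒≢ℓ p⁻x
    d<lift : d G x < lookup (lift η) x
    d<lift with position x
    ... | at-ℓ x≡ℓ = ⊥-elim (x≢ℓ x≡ℓ)
    ... | at-u refl rewrite d-u | lift-u η = s≤s d<η
    ... | elsewhere x≢ℓ x≢u rewrite d-elsewhere x≢ℓ x≢u | lift-elsewhere η x≢ℓ x≢u = d<η
    same-result : toppleAt G x (false ∷ toList B) (lift η) ≡ lift (toppleAt G⁻ x (toList B) η)
    same-result = vec-ext pointwise
      where
      L : List Bool
      L = toList B
      pointwise : ∀ w → lookup (toppleAt G x (false ∷ L) (lift η)) w ≡ lookup (lift (toppleAt G⁻ x L η)) w
      pointwise w with position w
      ... | at-ℓ refl rewrite lookup-toppleAt G x (false ∷ L) (lift η) ℓ | lift-ℓ (toppleAt G⁻ x L η)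
                            | ==-≢ (λ ℓ≡x → x≢ℓ (sym ℓ≡x)) | ==-≢ ℓ≢s | lift-ℓ η
                            | gain-to-isolated G x ℓ R L ℓ-isolated = refl
      ... | at-u refl rewrite lookup-toppleAt G x (false ∷ L) (lift η) u | lift-u (toppleAt G⁻ x L η)
                            | lookup-toppleAt G⁻ x L η u | ==-≢ u≢s
                            | gain-graph-irrelevant G G⁻ x u R L | lost-graph-irrelevant G G⁻ x R L with u ≟ x
      ...   | yes refl rewrite lift-u η = +-∸-assoc 1 (≤-trans (lost≤deg G⁻ u R L) (<⇒≤ d<η))
      ...   | no _     rewrite lift-u η = refl
      pointwise w | elsewhere w≢ℓ w≢u
        rewrite lookup-toppleAt G x (false ∷ L) (lift η) w | lift-elsewhere (toppleAt G⁻ x L η) w≢ℓ w≢u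
              | lookup-toppleAt G⁻ x L η w | gain-graph-irrelevant G G⁻ x w R L
              | lost-graph-irrelevant G G⁻ x R L with w ≟ x
      ...   | yes refl rewrite lift-elsewhere η w≢ℓ w≢u = refl
      ...   | no _     rewrite lift-elsewhere η w≢ℓ w≢u = refl

  lift-Stable : ∀ {η} → Stable G⁻ η → Stable G (lift η)
  lift-Stable {η} st w pw with position w
  ... | at-ℓ refl rewrite lift-ℓ η | d-ℓ = ≤-refl
  ... | at-u refl rewrite lift-u η | d-u = s≤s (st u p⁻-u)
  ... | elsewhere w≢ℓ w≢u rewrite lift-elsewhere η w≢ℓ w≢u | d-elsewhere w≢ℓ w≢u = st w (≡-trans (p⁻-≢ℓ w≢ℓ) pw)

  lift-Step : ∀ {η ζ} → Step G⁻ η ζ → Step G (lift η) (lift ζ)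
  lift-Step {η} {ζ} (v , p⁻v , topples , st) =
    v , p⁻⇒p p⁻v ,
    subst (λ ξ → Star (Topple G) ξ (lift ζ)) (lift-addGrain v η (p⁻⇒≢ℓ p⁻v))
          (gmap lift (λ {ξ} {ξ′} → lift-Topple {ξ} {ξ′}) topples) ,
    lift-Stable {ζ} st

  lift-Sto : ∀ {η} → Sto G⁻ η → Sto G (lift η)
  lift-Sto {η} (from-max , to-max) =
    subst (λ ξ → Star (Step G) ξ (lift η)) lift-ηmax (gmap lift (λ {ξ} {ξ′} → lift-Step {ξ} {ξ′}) from-max) ,
    subst (Star (Step G) (lift η)) lift-ηmax (gmap lift (λ {ξ} {ξ′} → lift-Step {ξ} {ξ′}) to-max)

  lack-lift : ∀ η → lack G (lift η) ≡ lack G⁻ η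
  lack-lift η = cong sum (tabulate-cong pointwise)
    where
    pointwise : ∀ w → (if p w then d G w ∸ lookup (lift η) w else 0) ≡ (if p⁻ w then d G⁻ w ∸ lookup η w else 0)
    pointwise w with position w
    ... | at-ℓ refl rewrite p⁻-ℓ | ℓ∈V | d-ℓ | lift-ℓ η = refl
    ... | at-u refl rewrite ==-≢ u≢ℓ | u∈V | d-u | lift-u η = refl
    ... | elsewhere w≢ℓ w≢u rewrite p⁻-≢ℓ w≢ℓ | d-elsewhere w≢ℓ w≢u | lift-elsewhere η w≢ℓ w≢u = refl

  Loaded : Config m → Set
  Loaded ζ = 1 ≤ lookup ζ ℓ × 1 ≤ lookup ζ u

  merge-resp : ∀ {ζ ξ} → Loaded ζ → Loaded ξ →
    lookup ξ u + lookup ξ ℓ ≡ lookup ζ u + lookup ζ ℓ →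
    (∀ w → ¬ w ≡ ℓ → ¬ w ≡ u → lookup ξ w ≡ lookup ζ w) → merge ξ ≡ merge ζ
  merge-resp {ζ} {ξ} (ζℓ≥1 , ζu≥1) (ξℓ≥1 , ξu≥1) sum≡ elsewhere≡ = vec-ext pointwise
    where
    pointwise : ∀ w → lookup (merge ξ) w ≡ lookup (merge ζ) w
    pointwise w with position w
    ... | at-ℓ refl rewrite merge-ℓ ξ | merge-ℓ ζ = refl
    ... | at-u refl rewrite merge-u ξ | merge-u ζ = pred-sum ξu≥1 ξℓ≥1 ζu≥1 ζℓ≥1 sum≡
      where
      pred-sum : ∀ {a b c e} → 1 ≤ a → 1 ≤ b → 1 ≤ c → 1 ≤ e → a + b ≡ c + e → pred a + pred b ≡ pred c + pred e
      pred-sum {suc a} {suc b} {suc c} {suc e} _ _ _ _ h =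
        suc-injective (≡-trans (sym (+-suc a b)) (≡-trans (suc-injective h) (+-suc c e)))
    ... | elsewhere w≢ℓ w≢u rewrite merge-elsewhere ξ w≢ℓ w≢u | merge-elsewhere ζ w≢ℓ w≢u = elsewhere≡ w w≢ℓ w≢u

  topple-ℓ-at-ℓ : ∀ ζ b B → lookup (toppleAt G ℓ (b ∷ B) ζ) ℓ ≡ lookup ζ ℓ ∸ [ b ]ᵇ
  topple-ℓ-at-ℓ ζ b B rewrite lookup-toppleAt G ℓ (b ∷ B) ζ ℓ | ==-refl ℓ | ℓ-on-e | lost-isolated G ℓ R B ℓ-isolated with b
  ... | true  = refl
  ... | false = refl

  topple-ℓ-at-u : ∀ ζ b B → lookup (toppleAt G ℓ (b ∷ B) ζ) u ≡ lookup ζ u + [ b ]ᵇ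
  topple-ℓ-at-u ζ b B rewrite lookup-toppleAt G ℓ (b ∷ B) ζ u | ==-≢ u≢ℓ | ==-≢ u≢s | ℓ-on-e | other-ℓ | ==-refl u
                            | gain-from-isolated G ℓ u R B ℓ-isolated with b
  ... | true  = refl
  ... | false = refl

  topple-ℓ-elsewhere : ∀ ζ b B w → ¬ w ≡ ℓ → ¬ w ≡ u → lookup (toppleAt G ℓ (b ∷ B) ζ) w ≡ lookup ζ w
  topple-ℓ-elsewhere ζ b B w w≢ℓ w≢u
    rewrite lookup-toppleAt G ℓ (b ∷ B) ζ w | ==-≢ w≢ℓ | ℓ-on-e | other-ℓ
          | ==-≢ (λ u≡w → w≢u (sym u≡w)) | gain-from-isolated G ℓ w R B ℓ-isolated with w == s
  ... | true  = refl
  ... | false with b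
  ...   | true  = +-identityʳ _
  ...   | false = +-identityʳ _

  -- Toppling the leaf only moves a grain between ℓ and u, which merge does not see.
  merge-Topple-ℓ : ∀ {ζ} b (B : List Bool) → d G ℓ < lookup ζ ℓ → Loaded ζ →
    Loaded (toppleAt G ℓ (b ∷ B) ζ) × merge (toppleAt G ℓ (b ∷ B) ζ) ≡ merge ζ
  merge-Topple-ℓ {ζ} b B d<ζ (ζℓ≥1 , ζu≥1) =
    loaded , merge-resp {ζ} {ξ} (ζℓ≥1 , ζu≥1) loaded sum≡ (topple-ℓ-elsewhere ζ b B)
    where
    ξ : Config m
    ξ = toppleAt G ℓ (b ∷ B) ζ
    move : ∀ a n c → 2 ≤ n → 1 ≤ n ∸ [ c ]ᵇ × (a + [ c ]ᵇ) + (n ∸ [ c ]ᵇ) ≡ a + n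
    move a (suc (suc n)) true  _ = s≤s z≤n , +-assoc a 1 (suc n)
    move a (suc (suc n)) false _ = s≤s z≤n , cong (_+ suc (suc n)) (+-identityʳ a)
    move a (suc zero)    _     (s≤s ())
    moved : 1 ≤ lookup ζ ℓ ∸ [ b ]ᵇ × (lookup ζ u + [ b ]ᵇ) + (lookup ζ ℓ ∸ [ b ]ᵇ) ≡ lookup ζ u + lookup ζ ℓ
    moved = move (lookup ζ u) (lookup ζ ℓ) b (subst (_< lookup ζ ℓ) d-ℓ d<ζ)
    loaded : Loaded ξ
    loaded = subst (1 ≤_) (sym (topple-ℓ-at-ℓ ζ b B)) (proj₁ moved) ,
             subst (1 ≤_) (sym (topple-ℓ-at-u ζ b B)) (≤-trans ζu≥1 (m≤m+n _ _))
    sum≡ : lookup ξ u + lookup ξ ℓ ≡ lookup ζ u + lookup ζ ℓ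
    sum≡ = ≡-trans (cong₂ _+_ (topple-ℓ-at-u ζ b B) (topple-ℓ-at-ℓ ζ b B)) (proj₂ moved)

  topple-u-at-u : ∀ ζ b B → lookup (toppleAt G u (b ∷ B) ζ) u ≡ lookup ζ u ∸ ([ b ]ᵇ + lost G u R B)
  topple-u-at-u ζ b B rewrite lookup-toppleAt G u (b ∷ B) ζ u | ==-refl u | u-on-e with b
  ... | true  = refl
  ... | false = refl

  topple-u-at-ℓ : ∀ ζ b B → lookup (toppleAt G u (b ∷ B) ζ) ℓ ≡ lookup ζ ℓ + [ b ]ᵇ
  topple-u-at-ℓ ζ b B rewrite lookup-toppleAt G u (b ∷ B) ζ ℓ | ==-≢ ℓ≢u | ==-≢ ℓ≢s | u-on-e | other-u | ==-refl ℓ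
                            | gain-to-isolated G u ℓ R B ℓ-isolated with b
  ... | true  = refl
  ... | false = refl

  topple-u-elsewhere : ∀ ζ b B w → ¬ w ≡ ℓ → ¬ w ≡ u → lookup (toppleAt G u (b ∷ B) ζ) w ≡
    (if w == s then lookup ζ w else lookup ζ w + gain G u w R B)
  topple-u-elsewhere ζ b B w w≢ℓ w≢u
    rewrite lookup-toppleAt G u (b ∷ B) ζ w | ==-≢ w≢u | u-on-e | other-u | ==-≢ (λ ℓ≡w → w≢ℓ (sym ℓ≡w)) with w == s
  ... | true  = refl
  ... | false with b
  ...   | true  = refl
  ...   | false = refl

  -- The grain u may send to ℓ is compensated in merge; in G⁻, u has one grain less and degree one less.
  merge-Topple-u : ∀ {ζ} b (B : Vec Bool (length R)) → d G u < lookup ζ u → Loaded ζ →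
    Loaded (toppleAt G u (b ∷ toList B) ζ) × Topple G⁻ (merge ζ) (merge (toppleAt G u (b ∷ toList B) ζ))
  merge-Topple-u {ζ} b B d<ζ (ζℓ≥1 , ζu≥1) =
    loaded , subst (Topple G⁻ (merge ζ)) same-result (topple u B p⁻-u d⁻<merge)
    where
    L : List Bool
    L = toList B
    ξ : Config m
    ξ = toppleAt G u (b ∷ L) ζ
    A C Lr : ℕ
    A = pred (lookup ζ u)
    C = pred (lookup ζ ℓ)
    Lr = lost G u R L
    d⁻<A : d G⁻ u < A
    d⁻<A = ≤-pred (subst₂ _<_ d-u (sym (suc-pred≥1 ζu≥1)) d<ζ)
    coin+Lr≤A : [ b ]ᵇ + Lr ≤ A
    coin+Lr≤A = ≤-trans (+-monoʳ-≤ [ b ]ᵇ (lost≤deg G u R L)) (coin+d≤ b)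
      where
      coin+d≤ : ∀ c → [ c ]ᵇ + d G⁻ u ≤ A
      coin+d≤ true  = d⁻<A
      coin+d≤ false = <⇒≤ d⁻<A
    d⁻<merge : d G⁻ u < lookup (merge ζ) u
    d⁻<merge rewrite merge-u ζ = ≤-trans d⁻<A (m≤m+n A C)
    loaded : Loaded ξ
    loaded rewrite topple-u-at-ℓ ζ b L | topple-u-at-u ζ b L =
      ≤-trans ζℓ≥1 (m≤m+n _ _) ,
      subst (λ n → 1 ≤ n ∸ ([ b ]ᵇ + Lr)) (suc-pred≥1 ζu≥1) (subst (1 ≤_) (sym (+-∸-assoc 1 coin+Lr≤A)) (s≤s z≤n))
    merge-ξ-u : lookup (merge ξ) u ≡ (A + C) ∸ Lr
    merge-ξ-u = begin
      lookup (merge ξ) u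
        ≡⟨ merge-u ξ ⟩
      pred (lookup ξ u) + pred (lookup ξ ℓ)
        ≡⟨ cong₂ (λ a c → pred a + pred c) (topple-u-at-u ζ b L) (topple-u-at-ℓ ζ b L) ⟩
      pred (lookup ζ u ∸ ([ b ]ᵇ + Lr)) + pred (lookup ζ ℓ + [ b ]ᵇ)
        ≡⟨ cong₂ (λ a c → pred (a ∸ ([ b ]ᵇ + Lr)) + pred (c + [ b ]ᵇ)) (sym (suc-pred≥1 ζu≥1)) (sym (suc-pred≥1 ζℓ≥1)) ⟩
      pred (suc A ∸ ([ b ]ᵇ + Lr)) + pred (suc C + [ b ]ᵇ)
        ≡⟨ pred-∸-coin A C Lr b coin+Lr≤A ⟩
      (A + C) ∸ Lr ∎
      where open ≡-Reasoning
    same-result : toppleAt G⁻ u L (merge ζ) ≡ merge ξ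
    same-result = vec-ext pointwise
      where
      pointwise : ∀ w → lookup (toppleAt G⁻ u L (merge ζ)) w ≡ lookup (merge ξ) w
      pointwise w with position w
      ... | at-ℓ refl rewrite merge-ℓ ξ | lookup-toppleAt G⁻ u L (merge ζ) ℓ | ==-≢ ℓ≢u | ==-≢ ℓ≢s | merge-ℓ ζ
                            | gain-to-isolated G⁻ u ℓ R L ℓ-isolated = refl
      ... | at-u refl rewrite merge-ξ-u | lookup-toppleAt G⁻ u L (merge ζ) u | ==-refl u | merge-u ζ
                            | lost-graph-irrelevant G⁻ G u R L = refl
      ... | elsewhere w≢ℓ w≢u rewrite merge-elsewhere ξ w≢ℓ w≢u | lookup-toppleAt G⁻ u L (merge ζ) w | ==-≢ w≢u
                                    | topple-u-elsewhere ζ b L w w≢ℓ w≢u | merge-elsewhere ζ w≢ℓ w≢u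
                                    | gain-graph-irrelevant G⁻ G u w R L = refl

  module _ (x : Fin m) (x≢ℓ : ¬ x ≡ ℓ) (x≢u : ¬ x ≡ u) where

    private
      x-off-e : incident x e ≡ false
      x-off-e = only-ℓ-u x x≢ℓ x≢u

    topple-x-at-x : ∀ ζ b B → lookup (toppleAt G x (b ∷ B) ζ) x ≡ lookup ζ x ∸ lost G x R B
    topple-x-at-x ζ b B rewrite lookup-toppleAt G x (b ∷ B) ζ x | ==-refl x | x-off-e with b
    ... | true  = refl
    ... | false = refl

    topple-x-at-ℓ : ∀ ζ b B → lookup (toppleAt G x (b ∷ B) ζ) ℓ ≡ lookup ζ ℓ
    topple-x-at-ℓ ζ b B rewrite lookup-toppleAt G x (b ∷ B) ζ ℓ | ==-≢ (λ ℓ≡x → x≢ℓ (sym ℓ≡x)) | ==-≢ ℓ≢s | x-off-e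
                              | gain-to-isolated G x ℓ R B ℓ-isolated with b
    ... | true  = +-identityʳ _
    ... | false = +-identityʳ _

    topple-x-elsewhere : ∀ ζ b B w → ¬ w ≡ x → lookup (toppleAt G x (b ∷ B) ζ) w ≡
      (if w == s then lookup ζ w else lookup ζ w + gain G x w R B)
    topple-x-elsewhere ζ b B w w≢x rewrite lookup-toppleAt G x (b ∷ B) ζ w | ==-≢ w≢x | x-off-e with w == s
    ... | true  = refl
    ... | false with b
    ...   | true  = refl
    ...   | false = refl

    merge-Topple-elsewhere : ∀ {ζ} b (B : Vec Bool (length R)) → p x ≡ true → d G x < lookup ζ x → Loaded ζ →
      Loaded (toppleAt G x (b ∷ toList B) ζ) × Topple G⁻ (merge ζ) (merge (toppleAt G x (b ∷ toList B) ζ))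
    merge-Topple-elsewhere {ζ} b B px d<ζ (ζℓ≥1 , ζu≥1) =
      loaded , subst (Topple G⁻ (merge ζ)) same-result (topple x B (≡-trans (p⁻-≢ℓ x≢ℓ) px) d⁻<merge)
      where
      L : List Bool
      L = toList B
      ξ : Config m
      ξ = toppleAt G x (b ∷ L) ζ
      d⁻<merge : d G⁻ x < lookup (merge ζ) x
      d⁻<merge rewrite merge-elsewhere ζ x≢ℓ x≢u = subst (_< lookup ζ x) (d-elsewhere x≢ℓ x≢u) d<ζ
      ξ-u : lookup ξ u ≡ lookup ζ u + gain G x u R L
      ξ-u = ≡-trans (topple-x-elsewhere ζ b L u (λ u≡x → x≢u (sym u≡x)))
                    (cong (λ c → if c then lookup ζ u else lookup ζ u + gain G x u R L) (==-≢ u≢s))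
      loaded : Loaded ξ
      loaded rewrite topple-x-at-ℓ ζ b L | ξ-u = ζℓ≥1 , ≤-trans ζu≥1 (m≤m+n _ _)
      same-result : toppleAt G⁻ x L (merge ζ) ≡ merge ξ
      same-result = vec-ext pointwise
        where
        pointwise : ∀ w → lookup (toppleAt G⁻ x L (merge ζ)) w ≡ lookup (merge ξ) w
        pointwise w with position w
        ... | at-ℓ refl rewrite merge-ℓ ξ | lookup-toppleAt G⁻ x L (merge ζ) ℓ | ==-≢ (λ ℓ≡x → x≢ℓ (sym ℓ≡x))
                              | ==-≢ ℓ≢s | merge-ℓ ζ | gain-to-isolated G⁻ x ℓ R L ℓ-isolated = refl
        ... | at-u refl rewrite merge-u ξ | lookup-toppleAt G⁻ x L (merge ζ) u | ==-≢ (λ u≡x → x≢u (sym u≡x))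
                              | ==-≢ u≢s | merge-u ζ | ξ-u | topple-x-at-ℓ ζ b L
                              | gain-graph-irrelevant G⁻ G x u R L = pred-+-swap (pred (lookup ζ ℓ)) _ ζu≥1
          where
          pred-+-swap : ∀ {a} c g → 1 ≤ a → pred a + c + g ≡ pred (a + g) + c
          pred-+-swap {suc a} c g _ =
            ≡-trans (+-assoc a c g) (≡-trans (cong (a +_) (+-comm c g)) (sym (+-assoc a g c)))
        pointwise w | elsewhere w≢ℓ w≢u with w ≟ x
        ... | yes refl rewrite merge-elsewhere ξ x≢ℓ x≢u | lookup-toppleAt G⁻ x L (merge ζ) x | ==-refl x
                             | topple-x-at-x ζ b L | merge-elsewhere ζ x≢ℓ x≢u | lost-graph-irrelevant G⁻ G x R L = refl
        ... | no w≢x rewrite merge-elsewhere ξ w≢ℓ w≢u | lookup-toppleAt G⁻ x L (merge ζ) w | ==-≢ w≢x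
                           | topple-x-elsewhere ζ b L w w≢x | merge-elsewhere ζ w≢ℓ w≢u
                           | gain-graph-irrelevant G⁻ G x w R L = refl

  merge-Topple : ∀ {ζ ξ} → Topple G ζ ξ → Loaded ζ → Loaded ξ × Star (Topple G⁻) (merge ζ) (merge ξ)
  merge-Topple {ζ} (topple x (b ∷ B) px d<ζ) loaded with position x
  ... | at-ℓ refl = let (loaded′ , unchanged) = merge-Topple-ℓ {ζ} b (toList B) d<ζ loaded
                    in loaded′ , subst (Star (Topple G⁻) (merge ζ)) (sym unchanged) ε
  ... | at-u refl = let (loaded′ , t) = merge-Topple-u {ζ} b B d<ζ loaded in loaded′ , t ◅ ε
  ... | elsewhere x≢ℓ x≢u = let (loaded′ , t) = merge-Topple-elsewhere x x≢ℓ x≢u {ζ} b B px d<ζ loaded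
                            in loaded′ , t ◅ ε

  merge-Topples : ∀ {ζ ξ} → Star (Topple G) ζ ξ → Loaded ζ → Loaded ξ × Star (Topple G⁻) (merge ζ) (merge ξ)
  merge-Topples ε loaded = loaded , ε
  merge-Topples {ζ} (_◅_ {j = ζ′} t ts) loaded =
    let (loaded′ , ts₁) = merge-Topple {ζ} {ζ′} t loaded
        (loaded″ , ts₂) = merge-Topples ts loaded′
    in loaded″ , ts₁ ◅◅ ts₂

  Settled : Config m → Set
  Settled ζ = lookup ζ ℓ ≡ 1 × 1 ≤ lookup ζ u

  redirect : Fin m → Fin m
  redirect v = if v == ℓ then u else v

  redirect-p⁻ : ∀ v → p v ≡ true → p⁻ (redirect v) ≡ true
  redirect-p⁻ v pv with v ≟ ℓ
  ... | yes _   = p⁻-u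
  ... | no v≢ℓ = ≡-trans (p⁻-≢ℓ v≢ℓ) pv

  -- A grain dropped on ℓ is, after merging, a grain dropped on u.
  merge-addGrain : ∀ v ζ → Settled ζ → Loaded (addGrain G v ζ) × merge (addGrain G v ζ) ≡ addGrain G⁻ (redirect v) (merge ζ)
  merge-addGrain v ζ (ζℓ≡1 , ζu≥1) with v ≟ ℓ
  ... | yes refl = loaded , vec-ext pointwise
    where
    loaded : Loaded (addGrain G ℓ ζ)
    loaded rewrite lookup-addGrain G ℓ ζ ℓ | ==-refl ℓ | lookup-addGrain G ℓ ζ u | ==-≢ u≢ℓ = s≤s z≤n , ζu≥1
    pointwise : ∀ w → lookup (merge (addGrain G ℓ ζ)) w ≡ lookup (addGrain G⁻ u (merge ζ)) w
    pointwise w with position w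
    ... | at-ℓ refl rewrite merge-ℓ (addGrain G ℓ ζ) | lookup-addGrain G⁻ u (merge ζ) ℓ | ==-≢ ℓ≢u | merge-ℓ ζ = refl
    ... | at-u refl rewrite merge-u (addGrain G ℓ ζ) | lookup-addGrain G⁻ u (merge ζ) u | ==-refl u | merge-u ζ
                          | lookup-addGrain G ℓ ζ u | ==-≢ u≢ℓ | lookup-addGrain G ℓ ζ ℓ | ==-refl ℓ | ζℓ≡1
      = ≡-trans (+-comm (pred (lookup ζ u)) 1) (cong suc (sym (+-identityʳ _)))
    ... | elsewhere w≢ℓ w≢u rewrite merge-elsewhere (addGrain G ℓ ζ) w≢ℓ w≢u | lookup-addGrain G⁻ u (merge ζ) w
                                  | ==-≢ w≢u | lookup-addGrain G ℓ ζ w | ==-≢ w≢ℓ | merge-elsewhere ζ w≢ℓ w≢u = refl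
  ... | no v≢ℓ = loaded , vec-ext pointwise
    where
    loaded : Loaded (addGrain G v ζ)
    loaded rewrite lookup-addGrain G v ζ ℓ | lookup-addGrain G v ζ u | ==-≢ (λ ℓ≡v → v≢ℓ (sym ℓ≡v)) | ζℓ≡1
      = s≤s z≤n , still≥1 (u == v)
      where
      still≥1 : ∀ c → 1 ≤ (if c then suc (lookup ζ u) else lookup ζ u)
      still≥1 true  = s≤s z≤n
      still≥1 false = ζu≥1
    pointwise : ∀ w → lookup (merge (addGrain G v ζ)) w ≡ lookup (addGrain G⁻ v (merge ζ)) w
    pointwise w with position w
    ... | at-ℓ refl rewrite merge-ℓ (addGrain G v ζ) | lookup-addGrain G⁻ v (merge ζ) ℓ
                          | ==-≢ (λ ℓ≡v → v≢ℓ (sym ℓ≡v)) | merge-ℓ ζ = refl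
    ... | at-u refl rewrite merge-u (addGrain G v ζ) | lookup-addGrain G⁻ v (merge ζ) u | merge-u ζ
                          | lookup-addGrain G v ζ u | lookup-addGrain G v ζ ℓ | ==-≢ (λ ℓ≡v → v≢ℓ (sym ℓ≡v)) with u ≟ v
    ...   | yes _ rewrite sym (suc-pred≥1 ζu≥1) = refl
    ...   | no _  = refl
    pointwise w | elsewhere w≢ℓ w≢u rewrite merge-elsewhere (addGrain G v ζ) w≢ℓ w≢u
                                          | lookup-addGrain G⁻ v (merge ζ) w | lookup-addGrain G v ζ w with w ≟ v
    ...   | yes _ rewrite merge-elsewhere ζ w≢ℓ w≢u = refl
    ...   | no _  rewrite merge-elsewhere ζ w≢ℓ w≢u = refl

  -- Stability of ℓ (degree 1) caps it at one grain, and Loaded keeps it from being empty.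
  merge-Step : ∀ {ζ ξ} → Step G ζ ξ → Settled ζ → Settled ξ × Step G⁻ (merge ζ) (merge ξ)
  merge-Step {ζ} {ξ} (v , pv , topples , st) settled =
    let (loaded , merged) = merge-addGrain v ζ settled
        ((ξℓ≥1 , ξu≥1) , topples⁻) = merge-Topples topples loaded
        ξℓ≡1 = ≤-antisym (subst (lookup ξ ℓ ≤_) d-ℓ (st ℓ ℓ∈V)) ξℓ≥1
    in (ξℓ≡1 , ξu≥1) ,
       (redirect v , redirect-p⁻ v pv , subst (λ η → Star (Topple G⁻) η (merge ξ)) merged topples⁻ , merge-Stable ξℓ≡1)
    where
    merge-Stable : lookup ξ ℓ ≡ 1 → Stable G⁻ (merge ξ)
    merge-Stable ξℓ≡1 w p⁻w with position w
    ... | at-ℓ w≡ℓ = ⊥-elim (p⁻⇒≢ℓ p⁻w w≡ℓ)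
    ... | at-u refl rewrite merge-u ξ | ξℓ≡1 | +-identityʳ (pred (lookup ξ u)) =
      pred-mono-≤ (subst (lookup ξ u ≤_) d-u (st u u∈V))
    ... | elsewhere w≢ℓ w≢u rewrite merge-elsewhere ξ w≢ℓ w≢u =
      subst (lookup ξ w ≤_) (d-elsewhere w≢ℓ w≢u) (st w (p⁻⇒p p⁻w))

  merge-Steps : ∀ {ζ ξ} → Star (Step G) ζ ξ → Settled ζ → Settled ξ × Star (Step G⁻) (merge ζ) (merge ξ)
  merge-Steps ε settled = settled , ε
  merge-Steps {ζ} (_◅_ {j = ζ′} s ss) settled =
    let (settled′ , s⁻) = merge-Step {ζ} {ζ′} s settled
        (settled″ , ss⁻) = merge-Steps ss settled′
    in settled″ , s⁻ ◅ ss⁻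

  ηmax-Settled : Settled (ηmax G)
  ηmax-Settled rewrite lookup-ηmax G ℓ | lookup-ηmax G u | ℓ∈V | u∈V | d-ℓ | d-u = refl , s≤s z≤n

  merge-ηmax : merge (ηmax G) ≡ ηmax G⁻
  merge-ηmax = vec-ext pointwise
    where
    pointwise : ∀ w → lookup (merge (ηmax G)) w ≡ lookup (ηmax G⁻) w
    pointwise w with position w
    ... | at-ℓ refl rewrite merge-ℓ (ηmax G) | lookup-ηmax G⁻ ℓ | p⁻-ℓ = refl
    ... | at-u refl rewrite merge-u (ηmax G) | lookup-ηmax G⁻ u | lookup-ηmax G u | lookup-ηmax G ℓ
                          | ==-≢ u≢ℓ | u∈V | ℓ∈V | d-u | d-ℓ = +-identityʳ _
    ... | elsewhere w≢ℓ w≢u rewrite merge-elsewhere (ηmax G) w≢ℓ w≢u | lookup-ηmax G⁻ w | lookup-ηmax G w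
                                  | p⁻-≢ℓ w≢ℓ | d-elsewhere w≢ℓ w≢u = refl

  merge-Sto : ∀ {ζ} → Sto G ζ → Sto G⁻ (merge ζ) × Settled ζ
  merge-Sto {ζ} (from-max , to-max) =
    let (settled , from-max⁻) = merge-Steps from-max ηmax-Settled
    in (subst (λ η → Star (Step G⁻) η (merge ζ)) merge-ηmax from-max⁻ ,
        subst (Star (Step G⁻) (merge ζ)) merge-ηmax (proj₂ (merge-Steps to-max settled))) ,
       settled

  lack-merge : ∀ ζ → Settled ζ → lack G⁻ (merge ζ) ≡ lack G ζ
  lack-merge ζ (ζℓ≡1 , ζu≥1) = cong sum (tabulate-cong pointwise)
    where
    pointwise : ∀ w → (if p⁻ w then d G⁻ w ∸ lookup (merge ζ) w else 0) ≡ (if p w then d G w ∸ lookup ζ w else 0)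
    pointwise w with position w
    ... | at-ℓ refl rewrite p⁻-ℓ | ℓ∈V | d-ℓ | ζℓ≡1 = refl
    ... | at-u refl rewrite ==-≢ u≢ℓ | u∈V | d-u | merge-u ζ | ζℓ≡1 | +-identityʳ (pred (lookup ζ u))
                          | sym (suc-pred≥1 ζu≥1) = refl
    ... | elsewhere w≢ℓ w≢u rewrite p⁻-≢ℓ w≢ℓ | d-elsewhere w≢ℓ w≢u | merge-elsewhere ζ w≢ℓ w≢u = refl

  lift-merge : ∀ ζ → Settled ζ → lift (merge ζ) ≡ ζ
  lift-merge ζ (ζℓ≡1 , ζu≥1) = vec-ext pointwise
    where
    pointwise : ∀ w → lookup (lift (merge ζ)) w ≡ lookup ζ w
    pointwise w with position w
    ... | at-ℓ refl rewrite lift-ℓ (merge ζ) | ζℓ≡1 = refl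
    ... | at-u refl rewrite lift-u (merge ζ) | merge-u ζ | ζℓ≡1 | +-identityʳ (pred (lookup ζ u)) = suc-pred≥1 ζu≥1
    ... | elsewhere w≢ℓ w≢u rewrite lift-elsewhere (merge ζ) w≢ℓ w≢u | merge-elsewhere ζ w≢ℓ w≢u = refl

  LeafEmpty : Config m → Set
  LeafEmpty η = lookup η ℓ ≡ 0

  Topple-LeafEmpty : ∀ {η ξ} → Topple G⁻ η ξ → LeafEmpty η → LeafEmpty ξ
  Topple-LeafEmpty {η} (topple x B p⁻x _) ηℓ≡0
    rewrite lookup-toppleAt G⁻ x (toList B) η ℓ | ==-≢ (λ ℓ≡x → p⁻⇒≢ℓ p⁻x (sym ℓ≡x)) | ==-≢ ℓ≢s | ηℓ≡0
    = gain-to-isolated G⁻ x ℓ R (toList B) ℓ-isolated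

  Step-LeafEmpty : ∀ {η ξ} → Step G⁻ η ξ → LeafEmpty η → LeafEmpty ξ
  Step-LeafEmpty {η} (v , p⁻v , topples , _) ηℓ≡0 = Topples-LeafEmpty topples added
    where
    Topples-LeafEmpty : ∀ {ξ ξ′} → Star (Topple G⁻) ξ ξ′ → LeafEmpty ξ → LeafEmpty ξ′
    Topples-LeafEmpty ε                      empty = empty
    Topples-LeafEmpty (_◅_ {i = ξ} {j = ξ′} t ts) empty = Topples-LeafEmpty ts (Topple-LeafEmpty {ξ} {ξ′} t empty)
    added : LeafEmpty (addGrain G⁻ v η)
    added rewrite lookup-addGrain G⁻ v η ℓ | ==-≢ (λ ℓ≡v → p⁻⇒≢ℓ p⁻v (sym ℓ≡v)) = ηℓ≡0

  Sto-LeafEmpty : ∀ {η} → Sto G⁻ η → LeafEmpty η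
  Sto-LeafEmpty (from-max , _) = Steps-LeafEmpty from-max ηmax-empty
    where
    ηmax-empty : LeafEmpty (ηmax G⁻)
    ηmax-empty rewrite lookup-ηmax G⁻ ℓ | p⁻-ℓ = refl
    Steps-LeafEmpty : ∀ {ξ ξ′} → Star (Step G⁻) ξ ξ′ → LeafEmpty ξ → LeafEmpty ξ′
    Steps-LeafEmpty ε                      empty = empty
    Steps-LeafEmpty (_◅_ {i = ξ} {j = ξ′} s ss) empty = Steps-LeafEmpty ss (Step-LeafEmpty {ξ} {ξ′} s empty)

  merge-lift : ∀ η → LeafEmpty η → merge (lift η) ≡ η
  merge-lift η ηℓ≡0 = vec-ext pointwise
    where
    pointwise : ∀ w → lookup (merge (lift η)) w ≡ lookup η w
    pointwise w with position w
    ... | at-ℓ refl rewrite merge-ℓ (lift η) | ηℓ≡0 = refl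
    ... | at-u refl rewrite merge-u (lift η) | lift-u η | lift-ℓ η = +-identityʳ _
    ... | elsewhere w≢ℓ w≢u rewrite merge-elsewhere (lift η) w≢ℓ w≢u | lift-elsewhere η w≢ℓ w≢u = refl

  IsLCoeff-removeLeaf : ∀ k n → IsLCoeff G⁻ k n ⇔ IsLCoeff G k n
  IsLCoeff-removeLeaf k n =
    mk⇔ (Card-resp-bij lift merge forth back merge∘lift lift∘merge)
        (Card-resp-bij merge lift back forth lift∘merge merge∘lift)
    where
    forth : ∀ η → Sto G⁻ η × lack G⁻ η ≡ k → Sto G (lift η) × lack G (lift η) ≡ k
    forth η (sto , lack≡k) = lift-Sto sto , ≡-trans (lack-lift η) lack≡k
    back : ∀ ζ → Sto G ζ × lack G ζ ≡ k → Sto G⁻ (merge ζ) × lack G⁻ (merge ζ) ≡ k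
    back ζ (sto , lack≡k) = proj₁ (merge-Sto sto) , ≡-trans (lack-merge ζ (proj₂ (merge-Sto sto))) lack≡k
    merge∘lift : ∀ η → Sto G⁻ η × lack G⁻ η ≡ k → merge (lift η) ≡ η
    merge∘lift η (sto , _) = merge-lift η (Sto-LeafEmpty sto)
    lift∘merge : ∀ ζ → Sto G ζ × lack G ζ ≡ k → lift (merge ζ) ≡ ζ
    lift∘merge ζ (sto , _) = lift-merge ζ (proj₂ (merge-Sto sto))

∑ : ∀ {m} → (Fin m → ℕ) → ℕ
∑ {m} f = sum (tabulate {n = m} f)

∑-cong : ∀ {m} {f g : Fin m → ℕ} → (∀ v → f v ≡ g v) → ∑ f ≡ ∑ g
∑-cong f≗g = cong sum (tabulate-cong f≗g)

∑-+ : ∀ {m} (f g : Fin m → ℕ) → ∑ (λ v → f v + g v) ≡ ∑ f + ∑ g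
∑-+ {zero}  f g = refl
∑-+ {suc m} f g = ≡-trans (cong (f zero + g zero +_) (∑-+ (λ v → f (suc v)) (λ v → g (suc v))))
                          (interchange (f zero) (g zero) (∑ (λ v → f (suc v))) (∑ (λ v → g (suc v))))

∑-mono-≤ : ∀ {m} {f g : Fin m → ℕ} → (∀ v → f v ≤ g v) → ∑ f ≤ ∑ g
∑-mono-≤ {zero}  f≤g = z≤n
∑-mono-≤ {suc m} f≤g = +-mono-≤ (f≤g zero) (∑-mono-≤ (λ v → f≤g (suc v)))

∑-zero : ∀ {m} (f : Fin m → ℕ) → (∀ v → f v ≡ 0) → ∑ f ≡ 0
∑-zero {zero}  f f≡0 = refl
∑-zero {suc m} f f≡0 rewrite f≡0 zero = ∑-zero (λ v → f (suc v)) (λ v → f≡0 (suc v))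

∑-single : ∀ {m} (f : Fin m → ℕ) a → (∀ v → ¬ v ≡ a → f v ≡ 0) → ∑ f ≡ f a
∑-single {suc m} f zero    f≡0 =
  ≡-trans (cong (f zero +_) (∑-zero (λ v → f (suc v)) (λ v → f≡0 (suc v) λ ()))) (+-identityʳ (f zero))
∑-single {suc m} f (suc a) f≡0 rewrite f≡0 zero (λ ()) =
  ∑-single (λ v → f (suc v)) a (λ v v≢a → f≡0 (suc v) (λ sv≡sa → v≢a (Finₚ.suc-injective sv≡sa)))

∑-indicator : ∀ {m} (a : Fin m) → ∑ (λ v → [ v == a ]ᵇ) ≡ 1
∑-indicator a = ≡-trans (∑-single (λ v → [ v == a ]ᵇ) a (λ v v≢a → cong [_]ᵇ (==-≢ v≢a))) (cong [_]ᵇ (==-refl a))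

≤-∑ : ∀ {m} (f : Fin m → ℕ) v → f v ≤ ∑ f
≤-∑ f zero    = m≤m+n _ _
≤-∑ f (suc v) = ≤-trans (≤-∑ (λ w → f (suc w)) v) (m≤n+m _ (f zero))

module _ {m} (S : Fin m → Bool) where

  ∑-edge : ∀ a b → ¬ a ≡ b → S a ≡ true → S b ≡ true → ∑ (λ v → if S v then [ incident v (a , b) ]ᵇ else 0) ≡ 2
  ∑-edge a b a≢b Sa Sb = begin
    ∑ (λ v → if S v then [ incident v (a , b) ]ᵇ else 0) ≡⟨ ∑-cong endpoints ⟩
    ∑ (λ v → [ v == a ]ᵇ + [ v == b ]ᵇ)                  ≡⟨ ∑-+ (λ v → [ v == a ]ᵇ) (λ v → [ v == b ]ᵇ) ⟩
    ∑ (λ v → [ v == a ]ᵇ) + ∑ (λ v → [ v == b ]ᵇ)        ≡⟨ cong₂ _+_ (∑-indicator a) (∑-indicator b) ⟩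
    2                                                    ∎
    where
    open ≡-Reasoning
    endpoints : ∀ v → (if S v then [ incident v (a , b) ]ᵇ else 0) ≡ [ v == a ]ᵇ + [ v == b ]ᵇ
    endpoints v with v ≟ a | v ≟ b
    ... | yes refl | yes refl = ⊥-elim (a≢b refl)
    ... | yes refl | no _     rewrite Sa | ==-refl v = refl
    ... | no v≢a   | yes refl rewrite Sb | ==-refl v | ==-≢ (λ a≡v → v≢a (sym a≡v)) = refl
    ... | no v≢a   | no v≢b   rewrite ==-≢ (λ a≡v → v≢a (sym a≡v)) | ==-≢ (λ b≡v → v≢b (sym b≡v)) with S v
    ...   | true  = refl
    ...   | false = refl

  handshake : ∀ (E : List (Edge m)) → (∀ {a b} → (a , b) ∈ E → ¬ a ≡ b × S a ≡ true × S b ≡ true) →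
    ∑ (λ v → if S v then deg E v else 0) ≡ 2 * length E
  handshake [] _ = ∑-zero _ (λ v → zero-either (S v))
    where
    zero-either : ∀ c → (if c then 0 else 0) ≡ 0
    zero-either true  = refl
    zero-either false = refl
  handshake ((a , b) ∷ E) ok = begin
    ∑ (λ v → if S v then [ incident v (a , b) ]ᵇ + deg E v else 0)
      ≡⟨ ∑-cong (λ v → if-+ (S v)) ⟩
    ∑ (λ v → (if S v then [ incident v (a , b) ]ᵇ else 0) + (if S v then deg E v else 0))
      ≡⟨ ∑-+ (λ v → if S v then [ incident v (a , b) ]ᵇ else 0) (λ v → if S v then deg E v else 0) ⟩
    ∑ (λ v → if S v then [ incident v (a , b) ]ᵇ else 0) + ∑ (λ v → if S v then deg E v else 0)
      ≡⟨ cong₂ _+_ (∑-edge a b a≢b Sa Sb) (handshake E (λ ab∈E → ok (there ab∈E))) ⟩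
    2 + 2 * length E
      ≡⟨ sym (*-suc 2 (length E)) ⟩
    2 * length ((a , b) ∷ E) ∎
    where
    open ≡-Reasoning
    a≢b : ¬ a ≡ b
    a≢b = proj₁ (ok (here refl))
    Sa : S a ≡ true
    Sa = proj₁ (proj₂ (ok (here refl)))
    Sb : S b ≡ true
    Sb = proj₂ (proj₂ (ok (here refl)))
    if-+ : ∀ {x y} c → (if c then x + y else 0) ≡ (if c then x else 0) + (if c then y else 0)
    if-+ true  = refl
    if-+ false = refl

last-step : ∀ {A : Set} {R : A → A → Set} {a b} → Star R a b → ¬ a ≡ b → Σ A (λ w → R w b)
last-step ε           a≢a = ⊥-elim (a≢a refl)
last-step (r ◅ rs) _ = go r rs
  where
  go : ∀ {A : Set} {R : A → A → Set} {a j b} → R a j → Star R j b → Σ A (λ w → R w b)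
  go r ε          = _ , r
  go _ (r ◅ rs) = go r rs

LoopFree : ∀ {m} → SGraph m → Set
LoopFree G = ∀ {a b} → (a , b) ∈ edges G → ¬ a ≡ b

module _ {m} {G : SGraph m} (loopFree : LoopFree G) (T : TreeBranch G) where

  tEdges⊆edges : ∀ {e} → e ∈ tEdges T → e ∈ edges G
  tEdges⊆edges e∈T = ∈-resp-↭ (↭-sym (split T)) (∈-++⁺ˡ e∈T)

  inT⇒≢root : ∀ {v} → inT T v ≡ true → ¬ v ≡ root T
  inT⇒≢root inTv refl with ≡-trans (sym (root∉T T)) inTv
  ... | ()

  inT⇒deg≥1 : ∀ v → inT T v ≡ true → 1 ≤ deg (tEdges T) v
  inT⇒deg≥1 v inTv with tConnected T v inTv
  ... | ε     = ⊥-elim (inT⇒≢root inTv refl)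
  ... | a ◅ _ = proj₁ (Adj⇒deg≥1 a)

  root-deg≥1 : ∀ {v} → inT T v ≡ true → 1 ≤ deg (tEdges T) (root T)
  root-deg≥1 inTv = proj₂ (Adj⇒deg≥1 (proj₂ (last-step (tConnected T _ inTv) (inT⇒≢root inTv))))

  inT-nonempty : ∀ {n} → countV (inT T) ≡ suc n → Σ (Fin m) λ v → inT T v ≡ true
  inT-nonempty count≡ with Finₚ.any? (λ v → inT T v Boolₚ.≟ true)
  ... | yes found = found
  ... | no none = ⊥-elim (0≢1+n (≡-trans (sym (∑-zero _ off)) count≡))
    where
    off : ∀ v → [ inT T v ]ᵇ ≡ 0
    off v with inT T v in inTv
    ... | true  = ⊥-elim (none (v , inTv))
    ... | false = refl

  -- Counting degrees over V′ ∪ {r}: the handshake lemma gives 2 |E′| = 2 |V′|, while a leafless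
  -- V′ alone would already contribute 2 |V′| and the root at least one more.
  TreeBranch-leaf : ∀ {n} → countV (inT T) ≡ suc n → Σ (Fin m) λ ℓ → inT T ℓ ≡ true × deg (tEdges T) ℓ ≡ 1
  TreeBranch-leaf count≡ with Finₚ.any? (λ v → (inT T v Boolₚ.≟ true) ×-dec (deg (tEdges T) v ℕₚ.≟ 1))
  ... | yes (ℓ , inTℓ , deg≡1) = ℓ , inTℓ , deg≡1
  ... | no no-leaf = ⊥-elim (<-irrefl refl (begin-strict
    2 * countV (inT T)                                               ≡⟨ sym twice-count ⟩
    ∑ (λ v → if inT T v then 2 else 0)                               ≤⟨ ∑-mono-≤ two≤deg ⟩
    ∑ (λ v → if inT T v then deg E′ v else 0)                        <⟨ m<m+n _ (root-deg≥1 (proj₂ (inT-nonempty count≡))) ⟩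
    ∑ (λ v → if inT T v then deg E′ v else 0) + deg E′ (root T)      ≡⟨ sym split-root ⟩
    ∑ (λ v → if S v then deg E′ v else 0)                            ≡⟨ handshake S E′ edge-ok ⟩
    2 * length E′                                                    ≡⟨ cong (2 *_) (tEdgeCount T) ⟩
    2 * countV (inT T)                                               ∎))
    where
    open ≤-Reasoning
    E′ : List (Edge m)
    E′ = tEdges T
    S : Fin m → Bool
    S v = inT T v ∨ (v == root T)
    S-endpoint : ∀ {a} → (inT T a ≡ true ⊎ a ≡ root T) → S a ≡ true
    S-endpoint (inj₁ inTa) rewrite inTa = refl
    S-endpoint {a} (inj₂ refl) rewrite ==-refl a = Boolₚ.∨-zeroʳ (inT T a)
    edge-ok : ∀ {a b} → (a , b) ∈ E′ → ¬ a ≡ b × S a ≡ true × S b ≡ true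
    edge-ok ab∈E′ = loopFree (tEdges⊆edges ab∈E′) ,
                    S-endpoint (proj₁ (tEndpoints T ab∈E′)) , S-endpoint (proj₂ (tEndpoints T ab∈E′))
    split-root : ∑ (λ v → if S v then deg E′ v else 0) ≡ ∑ (λ v → if inT T v then deg E′ v else 0) + deg E′ (root T)
    split-root = begin-equality
      ∑ (λ v → if S v then deg E′ v else 0)
        ≡⟨ ∑-cong root-apart ⟩
      ∑ (λ v → (if inT T v then deg E′ v else 0) + (if v == root T then deg E′ v else 0))
        ≡⟨ ∑-+ (λ v → if inT T v then deg E′ v else 0) (λ v → if v == root T then deg E′ v else 0) ⟩
      ∑ (λ v → if inT T v then deg E′ v else 0) + ∑ (λ v → if v == root T then deg E′ v else 0)
        ≡⟨ cong (∑ (λ v → if inT T v then deg E′ v else 0) +_) (≡-trans (∑-single _ (root T) (λ v v≢r → cong (λ c → if c then deg E′ v else 0) (==-≢ v≢r)))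
                                (cong (λ c → if c then deg E′ (root T) else 0) (==-refl (root T)))) ⟩
      ∑ (λ v → if inT T v then deg E′ v else 0) + deg E′ (root T) ∎
      where
      root-apart : ∀ v → (if S v then deg E′ v else 0) ≡ (if inT T v then deg E′ v else 0) + (if v == root T then deg E′ v else 0)
      root-apart v with v ≟ root T
      ... | yes refl rewrite root∉T T = refl
      ... | no _ with inT T v
      ...   | true  = sym (+-identityʳ _)
      ...   | false = refl
    two≤deg : ∀ v → (if inT T v then 2 else 0) ≤ (if inT T v then deg E′ v else 0)
    two≤deg v with inT T v in inTv
    ... | false = z≤n
    ... | true with deg E′ v in deg≡ | inT⇒deg≥1 v inTv
    ...   | suc zero    | _ = ⊥-elim (no-leaf (v , inTv , deg≡))
    ...   | suc (suc _) | _ = s≤s (s≤s z≤n)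
    twice-count : ∑ (λ v → if inT T v then 2 else 0) ≡ 2 * countV (inT T)
    twice-count = begin-equality
      ∑ (λ v → if inT T v then 2 else 0)                   ≡⟨ ∑-cong (λ v → double (inT T v)) ⟩
      ∑ (λ v → [ inT T v ]ᵇ + [ inT T v ]ᵇ)                ≡⟨ ∑-+ (λ v → [ inT T v ]ᵇ) (λ v → [ inT T v ]ᵇ) ⟩
      countV (inT T) + countV (inT T)                      ≡⟨ cong (countV (inT T) +_) (sym (+-identityʳ _)) ⟩
      2 * countV (inT T)                                   ∎
      where
      double : ∀ c → (if c then 2 else 0) ≡ [ c ]ᵇ + [ c ]ᵇ
      double true  = refl
      double false = refl

pick-edge : ∀ {m} (ℓ : Fin m) (E : List (Edge m)) → deg E ℓ ≡ 1 →
  Σ (Edge m) λ e → Σ (List (Edge m)) λ E⁻ → (E ↭ e ∷ E⁻) × incident ℓ e ≡ true × deg E⁻ ℓ ≡ 0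
pick-edge ℓ (e ∷ E) deg≡1 with incident ℓ e in ℓ-on-e
... | true  = e , E , refl , ℓ-on-e , suc-injective deg≡1
... | false with pick-edge ℓ E deg≡1
...   | f , E⁻ , E↭ , ℓ-on-f , deg≡0 = f , e ∷ E⁻ , ↭-trans (prep e E↭) (swap e f refl) , ℓ-on-f , deg≡0′
  where
  deg≡0′ : deg (e ∷ E⁻) ℓ ≡ 0
  deg≡0′ rewrite ℓ-on-e = deg≡0

joins-fst : ∀ {m} (a b : Fin m) → ¬ a ≡ b → Joins a b (a , b)
joins-fst a b a≢b = record
  { ℓ≢u = a≢b ; ℓ-on-e = incident-fst a b ; u-on-e = incident-snd a b
  ; other-ℓ = cong (λ c → if c then b else a) (==-refl a)
  ; other-u = cong (λ c → if c then b else a) (==-≢ a≢b)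
  ; only-ℓ-u = λ x x≢a x≢b → cong₂ _∨_ (==-≢ (λ a≡x → x≢a (sym a≡x))) (==-≢ (λ b≡x → x≢b (sym b≡x))) }

joins-snd : ∀ {m} (a b : Fin m) → ¬ a ≡ b → Joins b a (a , b)
joins-snd a b a≢b = record
  { ℓ≢u = λ b≡a → a≢b (sym b≡a) ; ℓ-on-e = incident-snd a b ; u-on-e = incident-fst a b
  ; other-ℓ = cong (λ c → if c then b else a) (==-≢ a≢b)
  ; other-u = cong (λ c → if c then b else a) (==-refl a)
  ; only-ℓ-u = λ x x≢b x≢a → cong₂ _∨_ (==-≢ (λ a≡x → x≢a (sym a≡x))) (==-≢ (λ b≡x → x≢b (sym b≡x))) }

joins-endpoint : ∀ {m} {ℓ a b : Fin m} → ¬ a ≡ b → incident ℓ (a , b) ≡ true →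
  Σ (Fin m) λ u → Joins ℓ u (a , b) × (u ≡ a ⊎ u ≡ b)
joins-endpoint {ℓ = ℓ} {a} {b} a≢b ℓ-on-e with a ≟ ℓ | b ≟ ℓ
... | yes refl | _        = b , joins-fst a b a≢b , inj₂ refl
... | no _     | yes refl = a , joins-snd a b a≢b , inj₁ refl
... | no _     | no _ with ℓ-on-e
...   | ()

module PruneLeaf {m} (G : SGraph m) (s∉V : inV G (sink G) ≡ false) (loopFree : LoopFree G)
  (T : TreeBranch G) {n} (count≡ : countV (inT T) ≡ suc n) where

  private
    E′ : List (Edge m)
    E′ = tEdges T
    r : Fin m
    r = root T

  leaf : Σ (Fin m) λ ℓ → inT T ℓ ≡ true × deg E′ ℓ ≡ 1
  leaf = TreeBranch-leaf loopFree T count≡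

  ℓ : Fin m
  ℓ = proj₁ leaf

  inT-ℓ : inT T ℓ ≡ true
  inT-ℓ = proj₁ (proj₂ leaf)

  picked : Σ (Edge m) λ e → Σ (List (Edge m)) λ E⁻ → (E′ ↭ e ∷ E⁻) × incident ℓ e ≡ true × deg E⁻ ℓ ≡ 0
  picked = pick-edge ℓ E′ (proj₂ (proj₂ leaf))

  e : Edge m
  e = proj₁ picked

  E′⁻ : List (Edge m)
  E′⁻ = proj₁ (proj₂ picked)

  E′↭ : E′ ↭ e ∷ E′⁻
  E′↭ = proj₁ (proj₂ (proj₂ picked))

  ℓ-isolated-in-E′⁻ : deg E′⁻ ℓ ≡ 0
  ℓ-isolated-in-E′⁻ = proj₂ (proj₂ (proj₂ (proj₂ picked)))

  e∈E′ : e ∈ E′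
  e∈E′ = ∈-resp-↭ (↭-sym E′↭) (here refl)

  E′⁻⊆E′ : ∀ {f} → f ∈ E′⁻ → f ∈ E′
  E′⁻⊆E′ f∈ = ∈-resp-↭ (↭-sym E′↭) (there f∈)

  neighbour : Σ (Fin m) λ u → Joins ℓ u e × (u ≡ proj₁ e ⊎ u ≡ proj₂ e)
  neighbour = joins-endpoint (loopFree (tEdges⊆edges loopFree T e∈E′)) (proj₁ (proj₂ (proj₂ (proj₂ picked))))

  u : Fin m
  u = proj₁ neighbour

  joins : Joins ℓ u e
  joins = proj₁ (proj₂ neighbour)

  open Joins joins

  ℓ≢r : ¬ ℓ ≡ r
  ℓ≢r = inT⇒≢root loopFree T inT-ℓ

  u-in-tree : inT T u ≡ true ⊎ u ≡ r
  u-in-tree with proj₂ (proj₂ neighbour)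
  ... | inj₁ u≡a = subst (λ x → inT T x ≡ true ⊎ x ≡ r) (sym u≡a) (proj₁ (tEndpoints T e∈E′))
  ... | inj₂ u≡b = subst (λ x → inT T x ≡ true ⊎ x ≡ r) (sym u≡b) (proj₂ (tEndpoints T e∈E′))

  u∈V : inV G u ≡ true
  u∈V with u-in-tree
  ... | inj₁ inT-u = inT⊆V T u inT-u
  ... | inj₂ u≡r   = subst (λ x → inV G x ≡ true) (sym u≡r) (root∈V T)

  rest-avoids-T : ∀ v → inT T v ≡ true → deg (rest T) v ≡ 0
  rest-avoids-T v inTv = +-cancelˡ-≡ (deg E′ v) (deg (rest T) v) 0 (begin
    deg E′ v + deg (rest T) v ≡⟨ sym (deg-++ E′ (rest T) v) ⟩
    deg (E′ ++ rest T) v      ≡⟨ sym (deg-↭ (split T) v) ⟩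
    deg (edges G) v           ≡⟨ sym (fullDegree T v inTv) ⟩
    deg E′ v                  ≡⟨ sym (+-identityʳ _) ⟩
    deg E′ v + 0              ∎)
    where open ≡-Reasoning

  R : List (Edge m)
  R = E′⁻ ++ rest T

  ℓ-isolated : deg R ℓ ≡ 0
  ℓ-isolated rewrite deg-++ E′⁻ (rest T) ℓ | ℓ-isolated-in-E′⁻ | rest-avoids-T ℓ inT-ℓ = refl

  open LeafRemoval (inV G) (sink G) e R ℓ u s∉V (inT⊆V T ℓ inT-ℓ) u∈V joins ℓ-isolated
    public using (p⁻; G⁻; IsLCoeff-removeLeaf)

  inT⁻ : Fin m → Bool
  inT⁻ v = inT T v ∧ not (v == ℓ)

  inT⁻-intro : ∀ {v} → inT T v ≡ true → ¬ v ≡ ℓ → inT⁻ v ≡ true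
  inT⁻-intro inTv v≢ℓ rewrite inTv | ==-≢ v≢ℓ = refl

  inT⁻⇒inT : ∀ {v} → inT⁻ v ≡ true → inT T v ≡ true
  inT⁻⇒inT h = proj₁ (∧-true h)

  inT⁻⇒≢ℓ : ∀ {v} → inT⁻ v ≡ true → ¬ v ≡ ℓ
  inT⁻⇒≢ℓ {v} h refl with ≡-trans (sym (cong (inT T v ∧_) (cong not (==-refl v)))) h
  ... | eq rewrite Boolₚ.∧-zeroʳ (inT T v) with eq
  ...   | ()

  p⁻-intro : ∀ {v} → inV G v ≡ true → ¬ v ≡ ℓ → p⁻ v ≡ true
  p⁻-intro Vv v≢ℓ rewrite Vv | ==-≢ v≢ℓ = refl

  E′⁻-avoids-ℓ : ∀ {a b} → (a , b) ∈ E′⁻ → ¬ a ≡ ℓ × ¬ b ≡ ℓ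
  E′⁻-avoids-ℓ {a} {b} ab∈ =
    (λ { refl → true≢false (≡-trans (sym (incident-fst a b)) (deg≡0-∉ ℓ-isolated-in-E′⁻ ab∈)) }) ,
    (λ { refl → true≢false (≡-trans (sym (incident-snd a b)) (deg≡0-∉ ℓ-isolated-in-E′⁻ ab∈)) })
    where
    true≢false : ¬ true ≡ false
    true≢false ()

  E′-at-ℓ : ∀ {a b} → (a , b) ∈ E′ → a ≡ ℓ ⊎ b ≡ ℓ → (a , b) ≡ e
  E′-at-ℓ ab∈ at-ℓ with ∈-resp-↭ E′↭ ab∈
  ... | here ab≡e = ab≡e
  ... | there ab∈⁻ with at-ℓ
  ...   | inj₁ a≡ℓ = ⊥-elim (proj₁ (E′⁻-avoids-ℓ ab∈⁻) a≡ℓ)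
  ...   | inj₂ b≡ℓ = ⊥-elim (proj₂ (E′⁻-avoids-ℓ ab∈⁻) b≡ℓ)

  on-e-≢ℓ⇒u : ∀ {x} → incident x e ≡ true → ¬ x ≡ ℓ → x ≡ u
  on-e-≢ℓ⇒u {x} x-on-e x≢ℓ with x ≟ u
  ... | yes x≡u = x≡u
  ... | no x≢u with ≡-trans (sym (only-ℓ-u x x≢ℓ x≢u)) x-on-e
  ...   | ()

  Adj-from-ℓ : ∀ {x y} → Adj E′ x y → x ≡ ℓ → y ≡ u
  Adj-from-ℓ {x} {y} (inj₁ xy∈) refl =
    on-e-≢ℓ⇒u (subst (λ f → incident y f ≡ true) (E′-at-ℓ xy∈ (inj₁ refl)) (incident-snd x y))
              (λ y≡ℓ → loopFree (tEdges⊆edges loopFree T xy∈) (sym y≡ℓ))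
  Adj-from-ℓ {x} {y} (inj₂ yx∈) refl =
    on-e-≢ℓ⇒u (subst (λ f → incident y f ≡ true) (E′-at-ℓ yx∈ (inj₂ refl)) (incident-fst y x))
              (λ y≡ℓ → loopFree (tEdges⊆edges loopFree T yx∈) y≡ℓ)

  Adj-to-ℓ : ∀ {x y} → Adj E′ x y → y ≡ ℓ → x ≡ u
  Adj-to-ℓ (inj₁ xy∈) = Adj-from-ℓ (inj₂ xy∈)
  Adj-to-ℓ (inj₂ yx∈) = Adj-from-ℓ (inj₁ yx∈)

  E′-avoiding-ℓ : ∀ {a b} → (a , b) ∈ E′ → ¬ a ≡ ℓ → ¬ b ≡ ℓ → (a , b) ∈ E′⁻
  E′-avoiding-ℓ {a} {b} ab∈ a≢ℓ b≢ℓ with ∈-resp-↭ E′↭ ab∈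
  ... | there ab∈⁻ = ab∈⁻
  ... | here refl with ≡-trans (sym ℓ-on-e) (cong₂ _∨_ (==-≢ a≢ℓ) (==-≢ b≢ℓ))
  ...   | ()

  Adj-avoiding-ℓ : ∀ {x y} → Adj E′ x y → ¬ x ≡ ℓ → ¬ y ≡ ℓ → Adj E′⁻ x y
  Adj-avoiding-ℓ (inj₁ xy∈) x≢ℓ y≢ℓ = inj₁ (E′-avoiding-ℓ xy∈ x≢ℓ y≢ℓ)
  Adj-avoiding-ℓ (inj₂ yx∈) x≢ℓ y≢ℓ = inj₂ (E′-avoiding-ℓ yx∈ y≢ℓ x≢ℓ)

  -- A path through the leaf enters and leaves it via u, so the detour u — ℓ — u can be cut out.
  shortcut : ∀ {v} → ¬ v ≡ ℓ → Star (Adj E′) v r → Star (Adj E′⁻) v r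
  shortcut v≢ℓ ε = ε
  shortcut v≢ℓ (_◅_ {j = w} a path) with w ≟ ℓ
  ... | no w≢ℓ = Adj-avoiding-ℓ a v≢ℓ w≢ℓ ◅ shortcut w≢ℓ path
  ... | yes w≡ℓ with path
  ...   | ε = ⊥-elim (ℓ≢r (sym w≡ℓ))
  ...   | a′ ◅ path′ = subst (λ x → Star (Adj E′⁻) x r) (≡-trans (Adj-from-ℓ a′ w≡ℓ) (sym (Adj-to-ℓ a w≡ℓ)))
                             (shortcut (λ x≡ℓ → u≢ℓ (≡-trans (sym (Adj-from-ℓ a′ w≡ℓ)) x≡ℓ)) path′)
    where
    u≢ℓ : ¬ u ≡ ℓ
    u≢ℓ u≡ℓ = ℓ≢u (sym u≡ℓ)

  count-inT : countV (inT T) ≡ suc (countV inT⁻)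
  count-inT = begin
    countV (inT T)                                  ≡⟨ ∑-cong split-ℓ ⟩
    ∑ (λ v → [ inT⁻ v ]ᵇ + [ v == ℓ ]ᵇ)             ≡⟨ ∑-+ (λ v → [ inT⁻ v ]ᵇ) (λ v → [ v == ℓ ]ᵇ) ⟩
    countV inT⁻ + ∑ (λ v → [ v == ℓ ]ᵇ)             ≡⟨ cong (countV inT⁻ +_) (∑-indicator ℓ) ⟩
    countV inT⁻ + 1                                 ≡⟨ +-comm (countV inT⁻) 1 ⟩
    suc (countV inT⁻)                               ∎
    where
    open ≡-Reasoning
    split-ℓ : ∀ v → [ inT T v ]ᵇ ≡ [ inT⁻ v ]ᵇ + [ v == ℓ ]ᵇ
    split-ℓ v with v ≟ ℓ
    ... | yes refl rewrite inT-ℓ = refl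
    ... | no _ with inT T v
    ...   | true  = refl
    ...   | false = refl

  T⁻ : TreeBranch G⁻
  T⁻ = record
    { inT = inT⁻
    ; root = r
    ; tEdges = E′⁻
    ; rest = rest T
    ; split = refl
    ; inT⊆V = λ v h → p⁻-intro (inT⊆V T v (inT⁻⇒inT h)) (inT⁻⇒≢ℓ h)
    ; root∈V = p⁻-intro (root∈V T) (λ r≡ℓ → ℓ≢r (sym r≡ℓ))
    ; root∉T = cong (_∧ not (r == ℓ)) (root∉T T)
    ; tEndpoints = λ ab∈ → endpoint (proj₁ (E′⁻-avoids-ℓ ab∈)) (proj₁ (tEndpoints T (E′⁻⊆E′ ab∈))) ,
                           endpoint (proj₂ (E′⁻-avoids-ℓ ab∈)) (proj₂ (tEndpoints T (E′⁻⊆E′ ab∈)))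
    ; tConnected = λ v h → shortcut (inT⁻⇒≢ℓ h) (tConnected T v (inT⁻⇒inT h))
    ; tEdgeCount = suc-injective (≡-trans (sym (↭-length E′↭)) (≡-trans (tEdgeCount T) count-inT))
    ; fullDegree = λ v h → begin
        deg E′⁻ v                  ≡⟨ sym (+-identityʳ _) ⟩
        deg E′⁻ v + 0              ≡⟨ cong (deg E′⁻ v +_) (sym (rest-avoids-T v (inT⁻⇒inT h))) ⟩
        deg E′⁻ v + deg (rest T) v ≡⟨ sym (deg-++ E′⁻ (rest T) v) ⟩
        deg R v                    ∎
    }
    where
    open ≡-Reasoning
    endpoint : ∀ {a} → ¬ a ≡ ℓ → (inT T a ≡ true ⊎ a ≡ r) → (inT⁻ a ≡ true ⊎ a ≡ r)
    endpoint a≢ℓ (inj₁ inTa) = inj₁ (inT⁻-intro inTa a≢ℓ)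
    endpoint a≢ℓ (inj₂ a≡r)  = inj₂ a≡r

  count-T⁻ : countV (inT T⁻) ≡ n
  count-T⁻ = suc-injective (≡-trans (sym count-inT) count≡)

  s∉V⁻ : inV G⁻ (sink G⁻) ≡ false
  s∉V⁻ = cong (_∧ not (sink G == ℓ)) s∉V

  loopFree⁻ : LoopFree G⁻
  loopFree⁻ ab∈R with ∈-++⁻ E′⁻ ab∈R
  ... | inj₁ ab∈E′⁻  = loopFree (tEdges⊆edges loopFree T (E′⁻⊆E′ ab∈E′⁻))
  ... | inj₂ ab∈rest = loopFree (∈-resp-↭ (↭-sym (split T)) (∈-++⁺ʳ E′ ab∈rest))

  IsLCoeff-∖T⁻ : ∀ k c → IsLCoeff (G ∖T T) k c ⇔ IsLCoeff (G⁻ ∖T T⁻) k c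
  IsLCoeff-∖T⁻ = IsLCoeff-cong same-vertices refl
    where
    same-vertices : ∀ v → (inV G v ∧ not (inT T v)) ≡ (p⁻ v ∧ not (inT⁻ v))
    same-vertices v with v ≟ ℓ
    ... | yes refl rewrite inT-ℓ | inT⊆V T v inT-ℓ = refl
    ... | no _ with inV G v | inT T v
    ...   | true  | true  = refl
    ...   | true  | false = refl
    ...   | false | _     = refl

  IsLCoeff-G⁻ : ∀ k c → IsLCoeff G⁻ k c ⇔ IsLCoeff G k c
  IsLCoeff-G⁻ k c = IsLCoeff-cong (λ _ → refl) (↭-sym (↭-trans (split T) (++⁺ʳ (rest T) E′↭))) k c
                    ⇔-∘ IsLCoeff-removeLeaf k c

IsLCoeff-prune-empty : ∀ {m} (G : SGraph m) (T : TreeBranch G) → countV (inT T) ≡ 0 →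
  ∀ k c → IsLCoeff (G ∖T T) k c ⇔ IsLCoeff G k c
IsLCoeff-prune-empty G T count≡0 = IsLCoeff-cong same-vertices rest↭edges
  where
  inT-false : ∀ v → inT T v ≡ false
  inT-false v with inT T v in inTv
  ... | false = refl
  ... | true with ≤-trans (≤-reflexive (cong [_]ᵇ (sym inTv))) (≤-trans (≤-∑ (λ w → [ inT T w ]ᵇ) v) (≤-reflexive count≡0))
  ...   | ()
  same-vertices : ∀ v → inV G v ∧ not (inT T v) ≡ inV G v
  same-vertices v rewrite inT-false v = Boolₚ.∧-identityʳ (inV G v)
  no-tree-edges : tEdges T ≡ []
  no-tree-edges with tEdges T | tEdgeCount T
  ... | []    | _ = refl
  ... | _ ∷ _ | length≡ with ≡-trans length≡ count≡0
  ...   | ()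
  rest↭edges : rest T ↭ edges G
  rest↭edges = ↭-sym (subst (λ E → edges G ↭ E ++ rest T) no-tree-edges (split T))

IsLCoeff-prune : ∀ n {m} (G : SGraph m) → inV G (sink G) ≡ false → LoopFree G → (T : TreeBranch G) →
  countV (inT T) ≡ n → ∀ k c → IsLCoeff (G ∖T T) k c ⇔ IsLCoeff G k c
IsLCoeff-prune zero    G _   _        T count≡ = IsLCoeff-prune-empty G T count≡
IsLCoeff-prune (suc n) G s∉V loopFree T count≡ k c =
  IsLCoeff-G⁻ k c ⇔-∘ (IsLCoeff-prune n G⁻ s∉V⁻ loopFree⁻ T⁻ count-T⁻ k c ⇔-∘ IsLCoeff-∖T⁻ k c)
  where open PruneLeaf G s∉V loopFree T count≡

lemma3p7 : ∀ {m} (G : SGraph m) → WellFormed G → (T : TreeBranch G) →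
           ∀ k n → IsLCoeff (G ∖T T) k n ⇔ IsLCoeff G k n
lemma3p7 G wf T = IsLCoeff-prune _ G (WellFormed.sink∉V wf) (WellFormed.loopFree wf) T refl
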